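{- For every $n\in\mathbb{N}$: $\mathrm{DN}(\mathrm{FO}[2n]),\mathrm{LS}(\mathrm{FO}[2n]),\mathrm{H}(\mathrm{FO}[2n])\le N_{\mathrm{FO}_n}$ and $\mathrm{DN}(\mathrm{MSO}[2n]),\mathrm{LS}(\mathrm{MSO}[2n]),\mathrm{H}(\mathrm{MSO}[2n])\le N_{\mathrm{MSO}_n}$.
   Context: Words are nonempty finite words over $\Sigma=\{l,r\}$, identified with word models (positions with linear order $<$ and unary predicates $P_l,P_r$). FO and MSO formulas are over $\{<,P_l,P_r\}$. Size: $\mathrm{sz}(\phi)=1$ for atomic $\phi$; $\mathrm{sz}(\psi\wedge\theta)=\mathrm{sz}(\psi\vee\theta)=\mathrm{sz}(\psi)+\mathrm{sz}(\theta)+1$; $\mathrm{sz}(\neg\psi)$ and $\mathrm{sz}$ of quantified formulas equal $\mathrm{sz}(\psi)+1$; $\mathrm{FO}[m]$, $\mathrm{MSO}[m]$ are the formulas of size at most $m$. Quantifier rank: $0$ for atomic, unchanged by $\neg$, max over $\wedge,\vee$, each quantifier adds $1$; $\mathrm{FO}_n$, $\mathrm{MSO}_n$ are the formulas of quantifier rank at most $n$. $w\equiv_L v$ iff $w,v$ satisfy the same $L$-sentences; $N_L$ is the number of $\equiv_L$-classes on $\Sigma$-words. A sentence defines $w$ if $w$ is its only model; $\mathrm{Def}(L)$ is the set of $L$-definable words, $\mathrm{DN}(L)=\max\{|w|:w\in\mathrm{Def}(L)\}$. $\mu(\phi)$ is the minimal length of a model of $\phi$ ($0$ if none); $\nu(\phi)$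 is the maximal length of a model ($0$ if no models or arbitrarily long models). $\mathrm{LS}(L)=\max\{\mu(\phi):\phi\in L\}$, $\mathrm{H}(L)=\max\{\nu(\phi):\phi\in L\}$. -}

module Defs where

open import Data.Nat using (ℕ; zero; suc; _+_; _≤_; _<_; _⊔_)
open import Data.Fin using (Fin)
open import Data.Vec using (Vec; []; _∷_; lookup)
open import Data.Bool using (Bool; true)
open import Data.List.NonEmpty using (List⁺; toList)
import Data.List.NonEmpty as L⁺
import Data.List as L
open import Data.Product using (Σ; ∃; _×_; _,_)
open import Data.Sum using (_⊎_)
open import Data.Empty using (⊥)
open import Relation.Nullary using (¬_)
open import Relation.Binary.PropositionalEquality using (_≡_)

data Letter : Set where
  l r : Letter

Word : Set
Word = List⁺ Letter

∣_∣ : Word → ℕ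
∣ w ∣ = L⁺.length w

Pos : Word → Set
Pos w = Fin ∣ w ∣

letterAt : (w : Word) → Pos w → Letter
letterAt w i = L.lookup (toList w) i

-- FO over {<, P_l, P_r} (with equality); variables are de Bruijn
-- indices in Fin k.

data FO (k : ℕ) : Set where
  _<′_ : Fin k → Fin k → FO k
  _≐_  : Fin k → Fin k → FO k
  Pl   : Fin k → FO k
  Pr   : Fin k → FO k
  _∧′_ : FO k → FO k → FO k
  _∨′_ : FO k → FO k → FO k
  ¬′_  : FO k → FO k
  ∃′_  : FO (suc k) → FO k
  ∀′_  : FO (suc k) → FO k

szFO : ∀ {k} → FO k → ℕ
szFO (x <′ y) = 1
szFO (x ≐ y)  = 1
szFO (Pl x)   = 1
szFO (Pr x)   = 1
szFO (φ ∧′ ψ) = szFO φ + szFO ψ + 1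
szFO (φ ∨′ ψ) = szFO φ + szFO ψ + 1
szFO (¬′ φ)   = szFO φ + 1
szFO (∃′ φ)   = szFO φ + 1
szFO (∀′ φ)   = szFO φ + 1

qrFO : ∀ {k} → FO k → ℕ
qrFO (x <′ y) = 0
qrFO (x ≐ y)  = 0
qrFO (Pl x)   = 0
qrFO (Pr x)   = 0
qrFO (φ ∧′ ψ) = qrFO φ ⊔ qrFO ψ
qrFO (φ ∨′ ψ) = qrFO φ ⊔ qrFO ψ
qrFO (¬′ φ)   = qrFO φ
qrFO (∃′ φ)   = suc (qrFO φ)
qrFO (∀′ φ)   = suc (qrFO φ)

satFO : ∀ {k} (w : Word) → Vec (Pos w) k → FO k → Set
satFO w ρ (x <′ y) = Data.Fin._<_ (lookup ρ x) (lookup ρ y)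
  where import Data.Fin
satFO w ρ (x ≐ y)  = lookup ρ x ≡ lookup ρ y
satFO w ρ (Pl x)   = letterAt w (lookup ρ x) ≡ l
satFO w ρ (Pr x)   = letterAt w (lookup ρ x) ≡ r
satFO w ρ (φ ∧′ ψ) = satFO w ρ φ × satFO w ρ ψ
satFO w ρ (φ ∨′ ψ) = satFO w ρ φ ⊎ satFO w ρ ψ
satFO w ρ (¬′ φ)   = ¬ satFO w ρ φ
satFO w ρ (∃′ φ)   = Σ (Pos w) λ i → satFO w (i ∷ ρ) φ
satFO w ρ (∀′ φ)   = (i : Pos w) → satFO w (i ∷ ρ) φ

_⊨FO_ : Word → FO 0 → Set
w ⊨FO φ = satFO w [] φ

-- MSO over {<, P_l, P_r} (with equality); first-order variables Fin k,
-- set variables Fin m (de Bruijn), sets of positions as characteristic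
-- vectors.

data MSO (k m : ℕ) : Set where
  _<′_ : Fin k → Fin k → MSO k m
  _≐_  : Fin k → Fin k → MSO k m
  Pl   : Fin k → MSO k m
  Pr   : Fin k → MSO k m
  _∈′_ : Fin k → Fin m → MSO k m
  _∧′_ : MSO k m → MSO k m → MSO k m
  _∨′_ : MSO k m → MSO k m → MSO k m
  ¬′_  : MSO k m → MSO k m
  ∃′_  : MSO (suc k) m → MSO k m
  ∀′_  : MSO (suc k) m → MSO k m
  ∃²_  : MSO k (suc m) → MSO k m
  ∀²_  : MSO k (suc m) → MSO k m

szMSO : ∀ {k m} → MSO k m → ℕ
szMSO (x <′ y) = 1
szMSO (x ≐ y)  = 1
szMSO (Pl x)   = 1
szMSO (Pr x)   = 1
szMSO (x ∈′ X) = 1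
szMSO (φ ∧′ ψ) = szMSO φ + szMSO ψ + 1
szMSO (φ ∨′ ψ) = szMSO φ + szMSO ψ + 1
szMSO (¬′ φ)   = szMSO φ + 1
szMSO (∃′ φ)   = szMSO φ + 1
szMSO (∀′ φ)   = szMSO φ + 1
szMSO (∃² φ)   = szMSO φ + 1
szMSO (∀² φ)   = szMSO φ + 1

qrMSO : ∀ {k m} → MSO k m → ℕ
qrMSO (x <′ y) = 0
qrMSO (x ≐ y)  = 0
qrMSO (Pl x)   = 0
qrMSO (Pr x)   = 0
qrMSO (x ∈′ X) = 0
qrMSO (φ ∧′ ψ) = qrMSO φ ⊔ qrMSO ψ
qrMSO (φ ∨′ ψ) = qrMSO φ ⊔ qrMSO ψ
qrMSO (¬′ φ)   = qrMSO φ
qrMSO (∃′ φ)   = suc (qrMSO φ)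
qrMSO (∀′ φ)   = suc (qrMSO φ)
qrMSO (∃² φ)   = suc (qrMSO φ)
qrMSO (∀² φ)   = suc (qrMSO φ)

PosSet : Word → Set
PosSet w = Vec Bool ∣ w ∣

satMSO : ∀ {k m} (w : Word) → Vec (Pos w) k → Vec (PosSet w) m → MSO k m → Set
satMSO w ρ σ (x <′ y) = Data.Fin._<_ (lookup ρ x) (lookup ρ y)
  where import Data.Fin
satMSO w ρ σ (x ≐ y)  = lookup ρ x ≡ lookup ρ y
satMSO w ρ σ (Pl x)   = letterAt w (lookup ρ x) ≡ l
satMSO w ρ σ (Pr x)   = letterAt w (lookup ρ x) ≡ r
satMSO w ρ σ (x ∈′ X) = lookup (lookup σ X) (lookup ρ x) ≡ true
satMSO w ρ σ (φ ∧′ ψ) = satMSO w ρ σ φ × satMSO w ρ σ ψ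
satMSO w ρ σ (φ ∨′ ψ) = satMSO w ρ σ φ ⊎ satMSO w ρ σ ψ
satMSO w ρ σ (¬′ φ)   = ¬ satMSO w ρ σ φ
satMSO w ρ σ (∃′ φ)   = Σ (Pos w) λ i → satMSO w (i ∷ ρ) σ φ
satMSO w ρ σ (∀′ φ)   = (i : Pos w) → satMSO w (i ∷ ρ) σ φ
satMSO w ρ σ (∃² φ)   = Σ (PosSet w) λ X → satMSO w ρ (X ∷ σ) φ
satMSO w ρ σ (∀² φ)   = (X : PosSet w) → satMSO w ρ (X ∷ σ) φ

_⊨MSO_ : Word → MSO 0 0 → Set
w ⊨MSO φ = satMSO w [] [] φ

-- Generic notions for a logic L, given as a type of sentences S,
-- a satisfaction relation, and a predicate selecting the sentences of L.

module Logic {S : Set} (_⊨_ : Word → S → Set) (InL : S → Set) where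

  Equiv : Word → Word → Set
  Equiv w v = (φ : S) → InL φ → (w ⊨ φ → v ⊨ φ) × (v ⊨ φ → w ⊨ φ)

  -- N is the number of ≡_L-classes on Σ-words (N_L = N):
  -- N pairwise inequivalent representatives covering all words.
  IsNumClasses : ℕ → Set
  IsNumClasses N =
    Σ (Fin N → Word) λ rep →
      ((i j : Fin N) → Equiv (rep i) (rep j) → i ≡ j) ×
      ((w : Word) → ∃ λ i → Equiv w (rep i))

  Defines : S → Word → Set
  Defines φ w = w ⊨ φ × ((v : Word) → v ⊨ φ → v ≡ w)

  Definable : Word → Set
  Definable w = ∃ λ φ → InL φ × Defines φ w

  IsMu : S → ℕ → Set
  IsMu φ m =
    (m ≡ 0 × ((w : Word) → ¬ (w ⊨ φ))) ⊎
    ((∃ λ w → w ⊨ φ × ∣ w ∣ ≡ m) × ((w : Word) → w ⊨ φ → m ≤ ∣ w ∣))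

  ArbLong : S → Set
  ArbLong φ = (k : ℕ) → ∃ λ w → w ⊨ φ × k ≤ ∣ w ∣

  IsNu : S → ℕ → Set
  IsNu φ m =
    (m ≡ 0 × (((w : Word) → ¬ (w ⊨ φ)) ⊎ ArbLong φ)) ⊎
    ((∃ λ w → w ⊨ φ × ∣ w ∣ ≡ m) × ((w : Word) → w ⊨ φ → ∣ w ∣ ≤ m))

  DN≤ : ℕ → Set
  DN≤ N = (w : Word) → Definable w → ∣ w ∣ ≤ N

  LS≤ : ℕ → Set
  LS≤ N = (φ : S) → InL φ → (m : ℕ) → IsMu φ m → m ≤ N

  H≤ : ℕ → Set
  H≤ N = (φ : S) → InL φ → (m : ℕ) → IsNu φ m → m ≤ N

-- the logics
-- FO[m] : FO sentences of size ≤ m ;  FO_n : FO sentences of rank ≤ n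
FOsize : ℕ → FO 0 → Set
FOsize m φ = szFO φ ≤ m

FOrank : ℕ → FO 0 → Set
FOrank n φ = qrFO φ ≤ n

MSOsize : ℕ → MSO 0 0 → Set
MSOsize m φ = szMSO φ ≤ m

MSOrank : ℕ → MSO 0 0 → Set
MSOrank n φ = qrMSO φ ≤ n

-- Duplicator wins the n-round Ehrenfeucht–Fraïssé game (with set moves for MSO) on two words
-- exactly when they agree on all sentences of quantifier rank n; one direction is given by
-- Hintikka formulas.  The game also decides every formula whose effective rank, which counts
-- only quantifiers whose variable occurs in their scope, is at most n.  As twice the effective
-- rank plus the number of free variables never exceeds size + 1, sentences of size 2n qualify.
-- Games on two pairs of words compose to a game on the concatenations, so rank-n equivalence
-- is a right congruence.  If w is longer than the number N of classes, two nonempty prefixes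
-- u and uz of w = uzs are equivalent, hence so are w and every uzᵏs.  A sentence of size 2n
-- therefore cannot define w, and w is neither a shortest nor a longest model of it.

module Submission where

open import Defs
open import Data.Bool using (Bool; true; false; T; if_then_else_)
open import Data.Bool.Properties using () renaming (_≟_ to _≟ᵇ_)
open import Data.Empty using (⊥-elim)
open import Data.Fin using (Fin; zero; suc; toℕ; punchIn)
import Data.Fin as Fin
open import Data.Fin.Properties using (toℕ-injective; toℕ<n; pigeonhole)
  renaming (_≟_ to _≟ᶠ_; _<?_ to _<ᶠ?_)
open import Data.Fin.Subset using (Subset; inside; outside; ⁅_⁆; _∪_; _⊆_; _∈_)
  renaming (⊥ to ∅; ∣_∣ to ∣_∣ₛ)
open import Data.Fin.Subset.Properties using (x∈⁅x⁆; p⊆p∪q; q⊆p∪q; ⊆-trans; ∣⊥∣≡0; ∣⁅x⁆∣≡1)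
open import Data.List using (List; []; _∷_; _++_; allFin)
import Data.List as List
open import Data.List.Membership.Propositional using () renaming (_∈_ to _∈ˡ_)
open import Data.List.Membership.Propositional.Properties using (∈-allFin; ∈-map⁺; ∈-++⁺ˡ; ∈-++⁺ʳ)
open import Data.List.NonEmpty using (toList; _⁺++_; _⁺++⁺_)
import Data.List.NonEmpty as L⁺
open import Data.List.Properties
  using (++-identityʳ; ++-assoc; length-++; take-take; take++drop≡id; length-take; length-drop)
import Data.List.Relation.Unary.Any as Any
open import Data.Maybe using (Maybe; just; nothing; _<∣>_)
import Data.Maybe as Maybe
open import Data.Maybe.Properties using (just-injective)
open import Data.Nat using (ℕ; zero; suc; _+_; _*_; _≤_; _<_; _⊔_; _⊓_; z≤n; s≤s)
import Data.Nat.Properties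
open Data.Nat.Properties
  using (<-asym; <⇒≢; <-irrefl; ≤-refl; ≤-reflexive; ≤-trans; <-≤-trans; ≤-<-trans; <⇒≤; ≤-pred; _≤?_; ≰⇒>;
         n≤1+n; n<1+n; m≤m+n; m≤n+m; m≤n⇒m≤1+n; m≤n⇒m≤n+o; +-suc; +-identityʳ;
         +-mono-≤; +-monoˡ-≤; +-monoʳ-≤; +-monoʳ-<; m⊔n≤o⇒m≤o; m⊔n≤o⇒n≤o; m⊔n≤m+n; ⊔-lub; ⊔-mono-≤;
         m≤n⇒m⊓n≡m; m<n⇒0<n∸m)
open import Data.Nat.Tactic.RingSolver using (solve-∀)
open import Data.Product using (Σ; ∃; _×_; _,_; proj₁; proj₂; map₂)
open import Data.Product.Function.NonDependent.Propositional using (_×-⇔_)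
open import Data.Sum using (_⊎_; inj₁; inj₂; [_,_]′)
import Data.Sum
open import Data.Sum.Function.Propositional using (_⊎-⇔_)
open import Data.Unit using (⊤; tt)
open import Data.Vec using (Vec; []; _∷_; lookup; insertAt; head; tail; here; there)
import Data.Vec as Vec
open import Data.Vec.Properties using (insertAt-lookup; insertAt-punchIn; lookup-map)
open import Function.Base using (_∘_)
open import Function.Bundles using (_⇔_; mk⇔; Equivalence)
import Function.Properties.Equivalence as ⇔
open import Function.Related.TypeIsomorphisms using (¬-cong-⇔)
open import Relation.Binary.PropositionalEquality
open import Relation.Nullary using (Dec; yes; no)

open Equivalence using (to; from)

variable
  A B : Set
  j m k n N : ℕ
  sets : Bool
  u v : Word

BackAndForth : (A → B → Set) → Set
BackAndForth R = (∀ a → ∃ λ b → R a b) × (∀ b → ∃ λ a → R a b)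

map-BackAndForth : {R S : A → B → Set} → (∀ {a b} → R a b → S a b) → BackAndForth R → BackAndForth S
map-BackAndForth f (forth , back) = (λ a → map₂ f (forth a)) , (λ b → map₂ f (back b))

BackAndForth-const : {R : A → B → Set} → A → B → (∀ a b → R a b) → BackAndForth R
BackAndForth-const a₀ b₀ rel = (λ a → b₀ , rel a b₀) , (λ b → a₀ , rel a₀ b)

BackAndForth-id : {R : A → A → Set} → (∀ a → R a a) → BackAndForth R
BackAndForth-id rel = (λ a → a , rel a) , (λ a → a , rel a)

Σ-⇔ : {P : A → Set} {Q : B → Set} → BackAndForth (λ a b → P a ⇔ Q b) → Σ A P ⇔ Σ B Q
Σ-⇔ (forth , back) = mk⇔ (λ (a , pa) → let b , e = forth a in b , to e pa)
                         (λ (b , qb) → let a , e = back b in a , from e qb)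

Π-⇔ : {P : A → Set} {Q : B → Set} → BackAndForth (λ a b → P a ⇔ Q b) → ((a : A) → P a) ⇔ ((b : B) → Q b)
Π-⇔ (forth , back) = mk⇔ (λ h b → let a , e = back b in to e (h a))
                         (λ h a → let b , e = forth a in from e (h b))

≡-⇔ : ∀ {x y z : A} → x ≡ y → (x ≡ z) ⇔ (y ≡ z)
≡-⇔ refl = ⇔.refl

⇔⇒× : A ⇔ B → (A → B) × (B → A)
⇔⇒× e = to e , from e

data Comparison : Set where
  less equal greater : Comparison

compare : ℕ → ℕ → Comparison
compare zero    zero    = equal
compare zero    (suc n) = less
compare (suc m) zero    = greater
compare (suc m) (suc n) = compare m n

data CompareSpec (m n : ℕ) : Comparison → Set where
  less    : m < n → CompareSpec m n less
  equal   : m ≡ n → CompareSpec m n equal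
  greater : n < m → CompareSpec m n greater

compare-spec : ∀ m n → CompareSpec m n (compare m n)
compare-spec zero    zero    = equal refl
compare-spec zero    (suc n) = less (s≤s z≤n)
compare-spec (suc m) zero    = greater (s≤s z≤n)
compare-spec (suc m) (suc n) with compare m n | compare-spec m n
... | _ | less q    = less (s≤s q)
... | _ | equal q   = equal (cong suc q)
... | _ | greater q = greater (s≤s q)

compare≡less⇔< : ∀ m n → compare m n ≡ less ⇔ m < n
compare≡less⇔< m n with compare m n | compare-spec m n
... | _ | less p    = mk⇔ (λ _ → p) (λ _ → refl)
... | _ | equal p   = mk⇔ (λ ()) (λ q → ⊥-elim (<⇒≢ q p))
... | _ | greater p = mk⇔ (λ ()) (λ q → ⊥-elim (<-asym p q))

compare≡equal⇔≡ : ∀ m n → compare m n ≡ equal ⇔ m ≡ n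
compare≡equal⇔≡ m n with compare m n | compare-spec m n
... | _ | less p    = mk⇔ (λ ()) (λ q → ⊥-elim (<⇒≢ p q))
... | _ | equal p   = mk⇔ (λ _ → p) (λ _ → refl)
... | _ | greater p = mk⇔ (λ ()) (λ q → ⊥-elim (<⇒≢ p (sym q)))

comparison-ext : {c c′ : Comparison} → (c ≡ less ⇔ c′ ≡ less) → (c ≡ equal ⇔ c′ ≡ equal) → c ≡ c′
comparison-ext {less}    c<⇔ c≡⇔ = sym (to c<⇔ refl)
comparison-ext {equal}   c<⇔ c≡⇔ = sym (to c≡⇔ refl)
comparison-ext {greater} {less}    c<⇔ c≡⇔ = from c<⇔ refl
comparison-ext {greater} {equal}   c<⇔ c≡⇔ = from c≡⇔ refl
comparison-ext {greater} {greater} c<⇔ c≡⇔ = refl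

<⇒compare≡less : m < n → compare m n ≡ less
<⇒compare≡less {m} {n} = from (compare≡less⇔< m n)

>⇒compare≡greater : n < m → compare m n ≡ greater
>⇒compare≡greater {n} {m} n<m with compare m n | compare-spec m n
... | _ | less m<n    = ⊥-elim (<-asym n<m m<n)
... | _ | equal m≡n   = ⊥-elim (<⇒≢ n<m (sym m≡n))
... | _ | greater _   = refl

compare-+ : ∀ k m n → compare (k + m) (k + n) ≡ compare m n
compare-+ zero    m n = refl
compare-+ (suc k) m n = compare-+ k m n

compare-cong : m < n ⇔ j < k → m ≡ n ⇔ j ≡ k → compare m n ≡ compare j k
compare-cong {m} {n} {j} {k} <⇔ ≡⇔ = comparison-ext
  (⇔.trans (compare≡less⇔< m n) (⇔.trans <⇔ (⇔.sym (compare≡less⇔< j k))))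
  (⇔.trans (compare≡equal⇔≡ m n) (⇔.trans ≡⇔ (⇔.sym (compare≡equal⇔≡ j k))))

compare⇒<⇔ : compare m n ≡ compare j k → m < n ⇔ j < k
compare⇒<⇔ {m} {n} {j} {k} e =
  ⇔.trans (⇔.sym (compare≡less⇔< m n)) (subst (λ c → c ≡ less ⇔ j < k) (sym e) (compare≡less⇔< j k))

compare⇒≡⇔ : compare m n ≡ compare j k → m ≡ n ⇔ j ≡ k
compare⇒≡⇔ {m} {n} {j} {k} e =
  ⇔.trans (⇔.sym (compare≡equal⇔≡ m n)) (subst (λ c → c ≡ equal ⇔ j ≡ k) (sym e) (compare≡equal⇔≡ j k))

toℕ-⇔ : ∀ {p q : Fin n} → (p ≡ q) ⇔ (toℕ p ≡ toℕ q)
toℕ-⇔ = mk⇔ (cong toℕ) toℕ-injective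

-- Ehrenfeucht–Fraïssé games

Env : Word → ℕ → Set
Env w j = Vec (Maybe (Pos w)) j

SetEnv : Word → ℕ → Set
SetEnv w m = Vec (Maybe (PosSet w)) m

letterOf : (w : Word) → Maybe (Pos w) → Maybe Letter
letterOf w = Maybe.map (letterAt w)

orderOf : Maybe (Fin n) → Maybe (Fin n) → Maybe Comparison
orderOf = Maybe.zipWith λ p q → compare (toℕ p) (toℕ q)

memberOf : Maybe (Fin n) → Maybe (Vec Bool n) → Maybe Bool
memberOf = Maybe.zipWith λ p X → lookup X p

-- All three codes are nothing as soon as a variable involved is unassigned, so a
-- partial isomorphism also matches which variables are assigned on the two sides.
record PartialIso (u : Word) (ρ : Env u j) (σ : SetEnv u m)
                  (v : Word) (ρ′ : Env v j) (σ′ : SetEnv v m) : Set where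
  field
    letter : ∀ x → letterOf u (lookup ρ x) ≡ letterOf v (lookup ρ′ x)
    order  : ∀ x y → orderOf (lookup ρ x) (lookup ρ y) ≡ orderOf (lookup ρ′ x) (lookup ρ′ y)
    member : ∀ x X → memberOf (lookup ρ x) (lookup σ X) ≡ memberOf (lookup ρ′ x) (lookup σ′ X)
open PartialIso

data Wins {j m} (sets : Bool) : ℕ → (u : Word) → Env u j → SetEnv u m →
                                     (v : Word) → Env v j → SetEnv v m → Set where
  done  : ∀ {u ρ σ v ρ′ σ′} → PartialIso u ρ σ v ρ′ σ′ → Wins sets zero u ρ σ v ρ′ σ′
  round : ∀ {k u ρ σ v ρ′ σ′} → PartialIso u ρ σ v ρ′ σ′ →
          BackAndForth (λ (i : Pos u) (i′ : Pos v) → Wins sets k u (just i ∷ ρ) σ v (just i′ ∷ ρ′) σ′) →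
          (T sets → BackAndForth (λ (X : PosSet u) (Y : PosSet v) →
                                    Wins sets k u ρ (just X ∷ σ) v ρ′ (just Y ∷ σ′))) →
          Wins sets (suc k) u ρ σ v ρ′ σ′

Wins⇒PartialIso : ∀ {u ρ σ v ρ′ σ′} → Wins {j} {m} sets k u ρ σ v ρ′ σ′ → PartialIso u ρ σ v ρ′ σ′
Wins⇒PartialIso (done iso)      = iso
Wins⇒PartialIso (round iso _ _) = iso

Wins-pred : ∀ k {u ρ σ v ρ′ σ′} → Wins {j} {m} sets (suc k) u ρ σ v ρ′ σ′ → Wins sets k u ρ σ v ρ′ σ′
Wins-pred zero    w                         = done (Wins⇒PartialIso w)
Wins-pred (suc k) (round iso points subsets) =
  round iso (map-BackAndForth (Wins-pred k) points) (λ s → map-BackAndForth (Wins-pred k) (subsets s))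

data InsertView (p : Fin (suc j)) : Fin (suc j) → Set where
  inserted : InsertView p p
  shifted  : (y : Fin j) → InsertView p (punchIn p y)

insertView : (p x : Fin (suc j)) → InsertView p x
insertView zero    zero    = inserted
insertView zero    (suc y) = shifted y
insertView {zero}  (suc ()) _
insertView {suc j} (suc p) zero = shifted zero
insertView {suc j} (suc p) (suc x) with insertView p x
... | inserted  = inserted
... | shifted y = shifted (suc y)

zipWith-nothingʳ : ∀ {C : Set} (f : A → B → C) a → Maybe.zipWith f a nothing ≡ nothing
zipWith-nothingʳ f (just a) = refl
zipWith-nothingʳ f nothing  = refl

PartialIso-insertPoint : ∀ {u ρ σ v ρ′ σ′} (p : Fin (suc j)) → PartialIso {j} {m} u ρ σ v ρ′ σ′ →
  PartialIso u (insertAt ρ p nothing) σ v (insertAt ρ′ p nothing) σ′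
PartialIso-insertPoint {j = j} {u = u} {ρ} {σ} {v} {ρ′} {σ′} p iso =
  record { letter = letter′ ; order = order′ ; member = member′ }
  where
  ρ₊ : Env u (suc j)
  ρ₊ = insertAt ρ p nothing
  ρ′₊ : Env v (suc j)
  ρ′₊ = insertAt ρ′ p nothing
  letter′ : ∀ x → letterOf u (lookup ρ₊ x) ≡ letterOf v (lookup ρ′₊ x)
  letter′ x with insertView p x
  ... | inserted  rewrite insertAt-lookup ρ p nothing | insertAt-lookup ρ′ p nothing = refl
  ... | shifted y rewrite insertAt-punchIn ρ p nothing y | insertAt-punchIn ρ′ p nothing y = letter iso y
  order′ : ∀ x y → orderOf (lookup ρ₊ x) (lookup ρ₊ y) ≡ orderOf (lookup ρ′₊ x) (lookup ρ′₊ y)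
  order′ x y with insertView p x | insertView p y
  ... | inserted   | _ rewrite insertAt-lookup ρ p nothing | insertAt-lookup ρ′ p nothing = refl
  ... | shifted x′ | inserted rewrite insertAt-lookup ρ p nothing | insertAt-lookup ρ′ p nothing =
    trans (zipWith-nothingʳ _ _) (sym (zipWith-nothingʳ _ _))
  ... | shifted x′ | shifted y′
    rewrite insertAt-punchIn ρ p nothing x′ | insertAt-punchIn ρ′ p nothing x′
          | insertAt-punchIn ρ p nothing y′ | insertAt-punchIn ρ′ p nothing y′ = order iso x′ y′
  member′ : ∀ x X → memberOf (lookup ρ₊ x) (lookup σ X) ≡ memberOf (lookup ρ′₊ x) (lookup σ′ X)
  member′ x X with insertView p x
  ... | inserted  rewrite insertAt-lookup ρ p nothing | insertAt-lookup ρ′ p nothing = refl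
  ... | shifted y rewrite insertAt-punchIn ρ p nothing y | insertAt-punchIn ρ′ p nothing y = member iso y X

PartialIso-insertSet : ∀ {u ρ σ v ρ′ σ′} (p : Fin (suc m)) → PartialIso {j} {m} u ρ σ v ρ′ σ′ →
  PartialIso u ρ (insertAt σ p nothing) v ρ′ (insertAt σ′ p nothing)
PartialIso-insertSet {m = m} {u = u} {ρ} {σ} {v} {ρ′} {σ′} p iso =
  record { letter = letter iso ; order = order iso ; member = member′ }
  where
  σ₊ : SetEnv u (suc m)
  σ₊ = insertAt σ p nothing
  σ′₊ : SetEnv v (suc m)
  σ′₊ = insertAt σ′ p nothing
  member′ : ∀ x X → memberOf (lookup ρ x) (lookup σ₊ X) ≡ memberOf (lookup ρ′ x) (lookup σ′₊ X)
  member′ x X with insertView p X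
  ... | inserted  rewrite insertAt-lookup σ p nothing | insertAt-lookup σ′ p nothing =
    trans (zipWith-nothingʳ _ _) (sym (zipWith-nothingʳ _ _))
  ... | shifted Y rewrite insertAt-punchIn σ p nothing Y | insertAt-punchIn σ′ p nothing Y = member iso x Y

Wins-insertPoint : ∀ k {u ρ σ v ρ′ σ′} (p : Fin (suc j)) → Wins {j} {m} sets k u ρ σ v ρ′ σ′ →
  Wins sets k u (insertAt ρ p nothing) σ v (insertAt ρ′ p nothing) σ′
Wins-insertPoint zero    p (done iso) = done (PartialIso-insertPoint p iso)
Wins-insertPoint (suc k) p (round iso points subsets) =
  round (PartialIso-insertPoint p iso) (map-BackAndForth (Wins-insertPoint k (suc p)) points)
        (λ s → map-BackAndForth (Wins-insertPoint k p) (subsets s))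

Wins-insertSet : ∀ k {u ρ σ v ρ′ σ′} (p : Fin (suc m)) → Wins {j} {m} sets k u ρ σ v ρ′ σ′ →
  Wins sets k u ρ (insertAt σ p nothing) v ρ′ (insertAt σ′ p nothing)
Wins-insertSet zero    p (done iso) = done (PartialIso-insertSet p iso)
Wins-insertSet (suc k) p (round iso points subsets) =
  round (PartialIso-insertSet p iso) (map-BackAndForth (Wins-insertSet k p) points)
        (λ s → map-BackAndForth (Wins-insertSet k (suc p)) (subsets s))

-- Effective rank

freeVars : MSO j m → Subset j
freeVars (x <′ y) = ⁅ x ⁆ ∪ ⁅ y ⁆
freeVars (x ≐ y)  = ⁅ x ⁆ ∪ ⁅ y ⁆
freeVars (Pl x)   = ⁅ x ⁆
freeVars (Pr x)   = ⁅ x ⁆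
freeVars (x ∈′ X) = ⁅ x ⁆
freeVars (φ ∧′ ψ) = freeVars φ ∪ freeVars ψ
freeVars (φ ∨′ ψ) = freeVars φ ∪ freeVars ψ
freeVars (¬′ φ)   = freeVars φ
freeVars (∃′ φ)   = tail (freeVars φ)
freeVars (∀′ φ)   = tail (freeVars φ)
freeVars (∃² φ)   = freeVars φ
freeVars (∀² φ)   = freeVars φ

freeSetVars : MSO j m → Subset m
freeSetVars (x <′ y) = ∅
freeSetVars (x ≐ y)  = ∅
freeSetVars (Pl x)   = ∅
freeSetVars (Pr x)   = ∅
freeSetVars (x ∈′ X) = ⁅ X ⁆
freeSetVars (φ ∧′ ψ) = freeSetVars φ ∪ freeSetVars ψ
freeSetVars (φ ∨′ ψ) = freeSetVars φ ∪ freeSetVars ψ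
freeSetVars (¬′ φ)   = freeSetVars φ
freeSetVars (∃′ φ)   = freeSetVars φ
freeSetVars (∀′ φ)   = freeSetVars φ
freeSetVars (∃² φ)   = tail (freeSetVars φ)
freeSetVars (∀² φ)   = tail (freeSetVars φ)

effRank : MSO j m → ℕ
effRank (x <′ y) = 0
effRank (x ≐ y)  = 0
effRank (Pl x)   = 0
effRank (Pr x)   = 0
effRank (x ∈′ X) = 0
effRank (φ ∧′ ψ) = effRank φ ⊔ effRank ψ
effRank (φ ∨′ ψ) = effRank φ ⊔ effRank ψ
effRank (¬′ φ)   = effRank φ
effRank (∃′ φ)   = if head (freeVars φ) then suc (effRank φ) else effRank φ
effRank (∀′ φ)   = if head (freeVars φ) then suc (effRank φ) else effRank φ
effRank (∃² φ)   = if head (freeSetVars φ) then suc (effRank φ) else effRank φ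
effRank (∀² φ)   = if head (freeSetVars φ) then suc (effRank φ) else effRank φ

Admissible : Bool → MSO j m → Set
Admissible sets (φ ∧′ ψ) = Admissible sets φ × Admissible sets ψ
Admissible sets (φ ∨′ ψ) = Admissible sets φ × Admissible sets ψ
Admissible sets (¬′ φ)   = Admissible sets φ
Admissible sets (∃′ φ)   = Admissible sets φ
Admissible sets (∀′ φ)   = Admissible sets φ
Admissible sets (∃² φ)   = T sets × Admissible sets φ
Admissible sets (∀² φ)   = T sets × Admissible sets φ
Admissible sets _        = ⊤

⊆-cons : ∀ {p : Subset (suc j)} {q : Subset j} → tail p ⊆ q → p ⊆ head p ∷ q
⊆-cons {p = _ ∷ _} tail⊆ here      = here
⊆-cons {p = _ ∷ _} tail⊆ (there x) = there (tail⊆ x)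

mask : Subset j → Vec A j → Vec (Maybe A) j
mask []      []      = []
mask (s ∷ U) (a ∷ ρ) = (if s then just a else nothing) ∷ mask U ρ

lookup-mask : ∀ {U : Subset j} {x} (ρ : Vec A j) → x ∈ U → lookup (mask U ρ) x ≡ just (lookup ρ x)
lookup-mask (a ∷ ρ) here      = refl
lookup-mask (a ∷ ρ) (there x) = lookup-mask ρ x

admissible-true : ∀ (φ : MSO j m) → Admissible true φ
admissible-true (x <′ y) = tt
admissible-true (x ≐ y)  = tt
admissible-true (Pl x)   = tt
admissible-true (Pr x)   = tt
admissible-true (x ∈′ X) = tt
admissible-true (φ ∧′ ψ) = admissible-true φ , admissible-true ψ
admissible-true (φ ∨′ ψ) = admissible-true φ , admissible-true ψ
admissible-true (¬′ φ)   = admissible-true φ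
admissible-true (∃′ φ)   = admissible-true φ
admissible-true (∀′ φ)   = admissible-true φ
admissible-true (∃² φ)   = tt , admissible-true φ
admissible-true (∀² φ)   = tt , admissible-true φ

binder≤ : ∀ (used : Bool) {e q} → e ≤ q → (if used then suc e else e) ≤ suc q
binder≤ true  e≤q = s≤s e≤q
binder≤ false e≤q = m≤n⇒m≤1+n e≤q

effRank≤qr : ∀ (φ : MSO j m) → effRank φ ≤ qrMSO φ
effRank≤qr (x <′ y) = z≤n
effRank≤qr (x ≐ y)  = z≤n
effRank≤qr (Pl x)   = z≤n
effRank≤qr (Pr x)   = z≤n
effRank≤qr (x ∈′ X) = z≤n
effRank≤qr (φ ∧′ ψ) = ⊔-mono-≤ (effRank≤qr φ) (effRank≤qr ψ)
effRank≤qr (φ ∨′ ψ) = ⊔-mono-≤ (effRank≤qr φ) (effRank≤qr ψ)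
effRank≤qr (¬′ φ)   = effRank≤qr φ
effRank≤qr (∃′ φ)   = binder≤ (head (freeVars φ)) (effRank≤qr φ)
effRank≤qr (∀′ φ)   = binder≤ (head (freeVars φ)) (effRank≤qr φ)
effRank≤qr (∃² φ)   = binder≤ (head (freeSetVars φ)) (effRank≤qr φ)
effRank≤qr (∀² φ)   = binder≤ (head (freeSetVars φ)) (effRank≤qr φ)

module MaskedIso {U : Subset j} {V : Subset m} {u ρ σ v ρ′ σ′}
  (iso : PartialIso u (mask U ρ) (mask V σ) v (mask U ρ′) (mask V σ′)) where

  letter-∈ : ∀ {x} → x ∈ U → letterAt u (lookup ρ x) ≡ letterAt v (lookup ρ′ x)
  letter-∈ {x} x∈U with letter iso x
  ... | e rewrite lookup-mask ρ x∈U | lookup-mask ρ′ x∈U = just-injective e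

  order-∈ : ∀ {x y} → x ∈ U → y ∈ U →
    compare (toℕ (lookup ρ x)) (toℕ (lookup ρ y)) ≡ compare (toℕ (lookup ρ′ x)) (toℕ (lookup ρ′ y))
  order-∈ {x} {y} x∈U y∈U with order iso x y
  ... | e rewrite lookup-mask ρ x∈U | lookup-mask ρ y∈U | lookup-mask ρ′ x∈U | lookup-mask ρ′ y∈U =
    just-injective e

  member-∈ : ∀ {x X} → x ∈ U → X ∈ V →
    lookup (lookup σ X) (lookup ρ x) ≡ lookup (lookup σ′ X) (lookup ρ′ x)
  member-∈ {x} {X} x∈U X∈V with member iso x X
  ... | e rewrite lookup-mask ρ x∈U | lookup-mask ρ′ x∈U | lookup-mask σ X∈V | lookup-mask σ′ X∈V =
    just-injective e

  less-∈ : ∀ {x y} → x ∈ U → y ∈ U → satMSO u ρ σ (x <′ y) ⇔ satMSO v ρ′ σ′ (x <′ y)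
  less-∈ x∈U y∈U = compare⇒<⇔ (order-∈ x∈U y∈U)

  equal-∈ : ∀ {x y} → x ∈ U → y ∈ U → satMSO u ρ σ (x ≐ y) ⇔ satMSO v ρ′ σ′ (x ≐ y)
  equal-∈ x∈U y∈U = ⇔.trans toℕ-⇔ (⇔.trans (compare⇒≡⇔ (order-∈ x∈U y∈U)) (⇔.sym toℕ-⇔))

x∈⁅x⁆∪⁅y⁆ : ∀ (x y : Fin n) → x ∈ ⁅ x ⁆ ∪ ⁅ y ⁆
x∈⁅x⁆∪⁅y⁆ x y = p⊆p∪q ⁅ y ⁆ (x∈⁅x⁆ x)

y∈⁅x⁆∪⁅y⁆ : ∀ (x y : Fin n) → y ∈ ⁅ x ⁆ ∪ ⁅ y ⁆
y∈⁅x⁆∪⁅y⁆ x y = q⊆p∪q ⁅ x ⁆ ⁅ y ⁆ (x∈⁅x⁆ y)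

-- The game is played only on the variables in U and V; a quantifier whose variable does
-- not occur is answered without spending a round.
mutual
  Wins-sound : ∀ (φ : MSO j m) {k u ρ σ v ρ′ σ′} (U : Subset j) (V : Subset m) →
    Admissible sets φ → effRank φ ≤ k → freeVars φ ⊆ U → freeSetVars φ ⊆ V →
    Wins sets k u (mask U ρ) (mask V σ) v (mask U ρ′) (mask V σ′) →
    satMSO u ρ σ φ ⇔ satMSO v ρ′ σ′ φ
  Wins-sound (x <′ y) U V _ _ f⊆ _ w = less-∈ (f⊆ (x∈⁅x⁆∪⁅y⁆ x y)) (f⊆ (y∈⁅x⁆∪⁅y⁆ x y))
    where open MaskedIso (Wins⇒PartialIso w)
  Wins-sound (x ≐ y) U V _ _ f⊆ _ w = equal-∈ (f⊆ (x∈⁅x⁆∪⁅y⁆ x y)) (f⊆ (y∈⁅x⁆∪⁅y⁆ x y))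
    where open MaskedIso (Wins⇒PartialIso w)
  Wins-sound (Pl x) U V _ _ f⊆ _ w = ≡-⇔ (letter-∈ (f⊆ (x∈⁅x⁆ x)))
    where open MaskedIso (Wins⇒PartialIso w)
  Wins-sound (Pr x) U V _ _ f⊆ _ w = ≡-⇔ (letter-∈ (f⊆ (x∈⁅x⁆ x)))
    where open MaskedIso (Wins⇒PartialIso w)
  Wins-sound (x ∈′ X) U V _ _ f⊆ s⊆ w = ≡-⇔ (member-∈ (f⊆ (x∈⁅x⁆ x)) (s⊆ (x∈⁅x⁆ X)))
    where open MaskedIso (Wins⇒PartialIso w)
  Wins-sound (φ ∧′ ψ) U V (aφ , aψ) e≤k f⊆ s⊆ w =
    Wins-sound φ U V aφ (m⊔n≤o⇒m≤o _ _ e≤k) (⊆-trans (p⊆p∪q _) f⊆) (⊆-trans (p⊆p∪q _) s⊆) w ×-⇔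
    Wins-sound ψ U V aψ (m⊔n≤o⇒n≤o _ _ e≤k) (⊆-trans (q⊆p∪q _ _) f⊆) (⊆-trans (q⊆p∪q _ _) s⊆) w
  Wins-sound (φ ∨′ ψ) U V (aφ , aψ) e≤k f⊆ s⊆ w =
    Wins-sound φ U V aφ (m⊔n≤o⇒m≤o _ _ e≤k) (⊆-trans (p⊆p∪q _) f⊆) (⊆-trans (p⊆p∪q _) s⊆) w ⊎-⇔
    Wins-sound ψ U V aψ (m⊔n≤o⇒n≤o _ _ e≤k) (⊆-trans (q⊆p∪q _ _) f⊆) (⊆-trans (q⊆p∪q _ _) s⊆) w
  Wins-sound (¬′ φ)   U V a e≤k f⊆ s⊆ w = ¬-cong-⇔ (Wins-sound φ U V a e≤k f⊆ s⊆ w)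
  Wins-sound (∃′ φ)   U V a e≤k f⊆ s⊆ w = Σ-⇔ (point-step φ U V a e≤k f⊆ s⊆ w)
  Wins-sound (∀′ φ)   U V a e≤k f⊆ s⊆ w = Π-⇔ (point-step φ U V a e≤k f⊆ s⊆ w)
  Wins-sound (∃² φ)   U V a e≤k f⊆ s⊆ w = Σ-⇔ (set-step φ U V a e≤k f⊆ s⊆ w)
  Wins-sound (∀² φ)   U V a e≤k f⊆ s⊆ w = Π-⇔ (set-step φ U V a e≤k f⊆ s⊆ w)

  point-step : ∀ (φ : MSO (suc j) m) {k u ρ σ v ρ′ σ′} (U : Subset j) (V : Subset m) →
    Admissible sets φ → effRank (∃′ φ) ≤ k → freeVars (∃′ φ) ⊆ U → freeSetVars φ ⊆ V →
    Wins sets k u (mask U ρ) (mask V σ) v (mask U ρ′) (mask V σ′) →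
    BackAndForth (λ (i : Pos u) (i′ : Pos v) → satMSO u (i ∷ ρ) σ φ ⇔ satMSO v (i′ ∷ ρ′) σ′ φ)
  point-step φ {k} U V a e≤k f⊆ s⊆ w with head (freeVars φ) | ⊆-cons {p = freeVars φ} f⊆
  point-step φ U V a (s≤s e≤k) f⊆ s⊆ (round _ points _) | true | f⊆′ =
    map-BackAndForth (Wins-sound φ (inside ∷ U) V a e≤k f⊆′ s⊆) points
  point-step φ {k} U V a e≤k f⊆ s⊆ w | false | f⊆′ =
    BackAndForth-const zero zero λ i i′ →
      Wins-sound φ (outside ∷ U) V a e≤k f⊆′ s⊆ (Wins-insertPoint k zero w)

  set-step : ∀ (φ : MSO j (suc m)) {k u ρ σ v ρ′ σ′} (U : Subset j) (V : Subset m) →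
    Admissible sets (∃² φ) → effRank (∃² φ) ≤ k → freeVars φ ⊆ U → freeSetVars (∃² φ) ⊆ V →
    Wins sets k u (mask U ρ) (mask V σ) v (mask U ρ′) (mask V σ′) →
    BackAndForth (λ (X : PosSet u) (Y : PosSet v) → satMSO u ρ (X ∷ σ) φ ⇔ satMSO v ρ′ (Y ∷ σ′) φ)
  set-step φ {k} U V a e≤k f⊆ s⊆ w with head (freeSetVars φ) | ⊆-cons {p = freeSetVars φ} s⊆
  set-step φ U V (s , a) (s≤s e≤k) f⊆ s⊆ (round _ _ subsets) | true | s⊆′ =
    map-BackAndForth (Wins-sound φ U (inside ∷ V) a e≤k f⊆ s⊆′) (subsets s)
  set-step φ {k} U V (_ , a) e≤k f⊆ s⊆ w | false | s⊆′ =
    BackAndForth-const ∅ ∅ λ X Y →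
      Wins-sound φ U (outside ∷ V) a e≤k f⊆ s⊆′ (Wins-insertSet k zero w)

∣p∪q∣≤∣p∣+∣q∣ : ∀ (p q : Subset n) → ∣ p ∪ q ∣ₛ ≤ ∣ p ∣ₛ + ∣ q ∣ₛ
∣p∪q∣≤∣p∣+∣q∣ []          []          = z≤n
∣p∪q∣≤∣p∣+∣q∣ (true ∷ p)  (true ∷ q)  =
  s≤s (≤-trans (∣p∪q∣≤∣p∣+∣q∣ p q) (+-monoʳ-≤ ∣ p ∣ₛ (n≤1+n _)))
∣p∪q∣≤∣p∣+∣q∣ (true ∷ p)  (false ∷ q) = s≤s (∣p∪q∣≤∣p∣+∣q∣ p q)
∣p∪q∣≤∣p∣+∣q∣ (false ∷ p) (true ∷ q)  =
  ≤-trans (s≤s (∣p∪q∣≤∣p∣+∣q∣ p q)) (≤-reflexive (sym (+-suc _ _)))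
∣p∪q∣≤∣p∣+∣q∣ (false ∷ p) (false ∷ q) = ∣p∪q∣≤∣p∣+∣q∣ p q

bind-point-bound : ∀ (p : Subset (suc j)) {e s z} → e + e + (∣ p ∣ₛ + s) ≤ suc z →
  (if head p then suc e else e) + (if head p then suc e else e) + (∣ tail p ∣ₛ + s) ≤ suc z + 1
bind-point-bound (true ∷ p) {e} {s} h = ≤-trans (≤-reflexive (reshuffle e ∣ p ∣ₛ s)) (+-monoˡ-≤ 1 h)
  where
  reshuffle : ∀ e c s → suc e + suc e + (c + s) ≡ e + e + (suc c + s) + 1
  reshuffle = solve-∀
bind-point-bound (false ∷ p) h = m≤n⇒m≤n+o 1 h

bind-set-bound : ∀ (p : Subset (suc m)) {e c z} → e + e + (c + ∣ p ∣ₛ) ≤ suc z →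
  (if head p then suc e else e) + (if head p then suc e else e) + (c + ∣ tail p ∣ₛ) ≤ suc z + 1
bind-set-bound (true ∷ p) {e} {c} h = ≤-trans (≤-reflexive (reshuffle e c ∣ p ∣ₛ)) (+-monoˡ-≤ 1 h)
  where
  reshuffle : ∀ e c s → suc e + suc e + (c + s) ≡ e + e + (c + suc s) + 1
  reshuffle = solve-∀
bind-set-bound (false ∷ p) h = m≤n⇒m≤n+o 1 h

join-bound : ∀ (e₁ e₂ : ℕ) (p₁ p₂ : Subset j) (q₁ q₂ : Subset m) {z₁ z₂} →
  e₁ + e₁ + (∣ p₁ ∣ₛ + ∣ q₁ ∣ₛ) ≤ suc z₁ → e₂ + e₂ + (∣ p₂ ∣ₛ + ∣ q₂ ∣ₛ) ≤ suc z₂ →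
  (e₁ ⊔ e₂) + (e₁ ⊔ e₂) + (∣ p₁ ∪ p₂ ∣ₛ + ∣ q₁ ∪ q₂ ∣ₛ) ≤ suc (z₁ + z₂ + 1)
join-bound e₁ e₂ p₁ p₂ q₁ q₂ {z₁} {z₂} h₁ h₂ = begin
  (e₁ ⊔ e₂) + (e₁ ⊔ e₂) + (∣ p₁ ∪ p₂ ∣ₛ + ∣ q₁ ∪ q₂ ∣ₛ)
    ≤⟨ +-mono-≤ (+-mono-≤ (m⊔n≤m+n e₁ e₂) (m⊔n≤m+n e₁ e₂))
                (+-mono-≤ (∣p∪q∣≤∣p∣+∣q∣ p₁ p₂) (∣p∪q∣≤∣p∣+∣q∣ q₁ q₂)) ⟩
  (e₁ + e₂) + (e₁ + e₂) + ((∣ p₁ ∣ₛ + ∣ p₂ ∣ₛ) + (∣ q₁ ∣ₛ + ∣ q₂ ∣ₛ))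
    ≡⟨ regroup e₁ e₂ ∣ p₁ ∣ₛ ∣ p₂ ∣ₛ ∣ q₁ ∣ₛ ∣ q₂ ∣ₛ ⟩
  (e₁ + e₁ + (∣ p₁ ∣ₛ + ∣ q₁ ∣ₛ)) + (e₂ + e₂ + (∣ p₂ ∣ₛ + ∣ q₂ ∣ₛ))
    ≤⟨ +-mono-≤ h₁ h₂ ⟩
  suc z₁ + suc z₂
    ≡⟨ suc-sum z₁ z₂ ⟩
  suc (z₁ + z₂ + 1) ∎
  where
  open Data.Nat.Properties.≤-Reasoning
  regroup : ∀ a b c d e f → (a + b) + (a + b) + ((c + d) + (e + f)) ≡ (a + a + (c + e)) + (b + b + (d + f))
  regroup = solve-∀
  suc-sum : ∀ a b → suc a + suc b ≡ suc (a + b + 1)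
  suc-sum = solve-∀

pair-bound : ∀ (x y : Fin j) → ∣ ⁅ x ⁆ ∪ ⁅ y ⁆ ∣ₛ + ∣ ∅ {n} ∣ₛ ≤ 2
pair-bound {n = n} x y rewrite ∣⊥∣≡0 n | +-identityʳ ∣ ⁅ x ⁆ ∪ ⁅ y ⁆ ∣ₛ =
  subst (∣ ⁅ x ⁆ ∪ ⁅ y ⁆ ∣ₛ ≤_) (cong₂ _+_ (∣⁅x⁆∣≡1 x) (∣⁅x⁆∣≡1 y))
        (∣p∪q∣≤∣p∣+∣q∣ ⁅ x ⁆ ⁅ y ⁆)

-- A quantifier that raises effRank adds one to the size and removes a free variable,
-- while an atom has size one and at most two free variables.
size-bound : ∀ (φ : MSO j m) → effRank φ + effRank φ + (∣ freeVars φ ∣ₛ + ∣ freeSetVars φ ∣ₛ) ≤ suc (szMSO φ)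
size-bound {m = m} (x <′ y) = pair-bound {n = m} x y
size-bound {m = m} (x ≐ y)  = pair-bound {n = m} x y
size-bound {m = m} (Pl x) rewrite ∣⁅x⁆∣≡1 x | ∣⊥∣≡0 m = s≤s z≤n
size-bound {m = m} (Pr x) rewrite ∣⁅x⁆∣≡1 x | ∣⊥∣≡0 m = s≤s z≤n
size-bound (x ∈′ X) rewrite ∣⁅x⁆∣≡1 x | ∣⁅x⁆∣≡1 X = ≤-refl
size-bound (φ ∧′ ψ) = join-bound (effRank φ) (effRank ψ) (freeVars φ) (freeVars ψ) (freeSetVars φ) (freeSetVars ψ)
                                 (size-bound φ) (size-bound ψ)
size-bound (φ ∨′ ψ) = join-bound (effRank φ) (effRank ψ) (freeVars φ) (freeVars ψ) (freeSetVars φ) (freeSetVars ψ)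
                                 (size-bound φ) (size-bound ψ)
size-bound (¬′ φ)   = m≤n⇒m≤n+o 1 (size-bound φ)
size-bound (∃′ φ)   = bind-point-bound (freeVars φ) (size-bound φ)
size-bound (∀′ φ)   = bind-point-bound (freeVars φ) (size-bound φ)
size-bound (∃² φ)   = bind-set-bound (freeSetVars φ) (size-bound φ)
size-bound (∀² φ)   = bind-set-bound (freeSetVars φ) (size-bound φ)

half-≤ : ∀ {e n} → e + e ≤ suc (n + n) → e ≤ n
half-≤ {e} {n} h with e ≤? n
... | yes e≤n = e≤n
... | no  e≰n = ⊥-elim (<-irrefl refl (≤-trans (≤-reflexive (sym (+-suc (suc n) n))) (≤-trans (+-mono-≤ n<e n<e) h)))
  where
  n<e : n < e
  n<e = ≰⇒> e≰n

size⇒effRank≤ : ∀ (φ : MSO 0 0) → szMSO φ ≤ 2 * n → effRank φ ≤ n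
size⇒effRank≤ {n} φ sz≤ with freeVars φ | freeSetVars φ | size-bound φ
... | [] | [] | bound = half-≤ (begin
  effRank φ + effRank φ      ≡⟨ sym (+-identityʳ _) ⟩
  effRank φ + effRank φ + 0  ≤⟨ bound ⟩
  suc (szMSO φ)              ≤⟨ s≤s sz≤ ⟩
  suc (2 * n)                ≡⟨ cong (λ n′ → suc (n + n′)) (+-identityʳ n) ⟩
  suc (n + n)                ∎)
  where open Data.Nat.Properties.≤-Reasoning

-- Hintikka formulas

-- The syntax has no truth constant: nothing stands for the true formula.
MSO⊤ : ℕ → ℕ → Set
MSO⊤ j m = Maybe (MSO j m)

Holds : (MSO j m → Set) → MSO⊤ j m → Set
Holds P nothing  = ⊤
Holds P (just φ) = P φ

infixr 6 _∧⊤_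
infixr 5 _∨⊤_

_∧⊤_ : MSO⊤ j m → MSO⊤ j m → MSO⊤ j m
nothing ∧⊤ g       = g
just φ  ∧⊤ nothing = just φ
just φ  ∧⊤ just ψ  = just (φ ∧′ ψ)

_∨⊤_ : MSO⊤ j m → MSO⊤ j m → MSO⊤ j m
just φ  ∨⊤ just ψ = just (φ ∨′ ψ)
_       ∨⊤ _      = nothing

∃⊤ ∀⊤ : MSO⊤ (suc j) m → MSO⊤ j m
∃⊤ = Maybe.map ∃′_
∀⊤ = Maybe.map ∀′_

∃²⊤ ∀²⊤ : MSO⊤ j (suc m) → MSO⊤ j m
∃²⊤ = Maybe.map ∃²_
∀²⊤ = Maybe.map ∀²_

⋀ : List A → (A → MSO⊤ j m) → MSO⊤ j m
⋀ []       f = nothing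
⋀ (a ∷ as) f = f a ∧⊤ ⋀ as f

-- The extra disjunct a₀ keeps the disjunction nonempty: there is no false formula either.
⋁ : A → List A → (A → MSO⊤ j m) → MSO⊤ j m
⋁ a₀ []       f = f a₀
⋁ a₀ (a ∷ as) f = f a ∨⊤ ⋁ a₀ as f

module _ {P : MSO j m → Set} where

  ∧⊤-closed : (∀ {φ ψ} → P φ → P ψ → P (φ ∧′ ψ)) → ∀ f g → Holds P f → Holds P g → Holds P (f ∧⊤ g)
  ∧⊤-closed ∧-closed nothing  g        _  pg = pg
  ∧⊤-closed ∧-closed (just φ) nothing  pf _  = pf
  ∧⊤-closed ∧-closed (just φ) (just ψ) pf pg = ∧-closed pf pg

  ∨⊤-closed : (∀ {φ ψ} → P φ → P ψ → P (φ ∨′ ψ)) → ∀ f g → Holds P f → Holds P g → Holds P (f ∨⊤ g)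
  ∨⊤-closed ∨-closed nothing  g        _  _  = tt
  ∨⊤-closed ∨-closed (just φ) nothing  _  _  = tt
  ∨⊤-closed ∨-closed (just φ) (just ψ) pf pg = ∨-closed pf pg

  ⋀-closed : (∀ {φ ψ} → P φ → P ψ → P (φ ∧′ ψ)) → (as : List A) (f : A → MSO⊤ j m) →
    (∀ a → Holds P (f a)) → Holds P (⋀ as f)
  ⋀-closed ∧-closed []       f pf = tt
  ⋀-closed ∧-closed (a ∷ as) f pf = ∧⊤-closed ∧-closed (f a) (⋀ as f) (pf a) (⋀-closed ∧-closed as f pf)

  ⋁-closed : (∀ {φ ψ} → P φ → P ψ → P (φ ∨′ ψ)) → (a₀ : A) (as : List A) (f : A → MSO⊤ j m) →
    (∀ a → Holds P (f a)) → Holds P (⋁ a₀ as f)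
  ⋁-closed ∨-closed a₀ []       f pf = pf a₀
  ⋁-closed ∨-closed a₀ (a ∷ as) f pf = ∨⊤-closed ∨-closed (f a) (⋁ a₀ as f) (pf a) (⋁-closed ∨-closed a₀ as f pf)

module _ {u : Word} {ρ : Vec (Pos u) j} {σ : Vec (PosSet u) m} where
  private
    Sat : MSO⊤ j m → Set
    Sat = Holds (satMSO u ρ σ)

  ∧⊤-elim : ∀ f g → Sat (f ∧⊤ g) → Sat f × Sat g
  ∧⊤-elim nothing  g        s = tt , s
  ∧⊤-elim (just φ) nothing  s = s , tt
  ∧⊤-elim (just φ) (just ψ) s = s

  ∨⊤-introˡ : ∀ f g → Sat f → Sat (f ∨⊤ g)
  ∨⊤-introˡ (just φ) (just ψ) s = inj₁ s
  ∨⊤-introˡ (just φ) nothing  s = tt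
  ∨⊤-introˡ nothing  g        s = tt

  ∨⊤-introʳ : ∀ f g → Sat g → Sat (f ∨⊤ g)
  ∨⊤-introʳ (just φ) (just ψ) s = inj₂ s
  ∨⊤-introʳ (just φ) nothing  s = tt
  ∨⊤-introʳ nothing  g        s = tt

  ∨⊤-elim : ∀ f g → Sat (f ∨⊤ g) → Sat f ⊎ Sat g
  ∨⊤-elim (just φ) (just ψ) s = s
  ∨⊤-elim (just φ) nothing  s = inj₂ tt
  ∨⊤-elim nothing  g        s = inj₁ tt

  ∧⊤-intro : ∀ f g → Sat f → Sat g → Sat (f ∧⊤ g)
  ∧⊤-intro = ∧⊤-closed _,_

  ⋀-intro : (as : List A) (f : A → MSO⊤ j m) → (∀ a → Sat (f a)) → Sat (⋀ as f)
  ⋀-intro = ⋀-closed _,_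

  ⋀-elim : (as : List A) (f : A → MSO⊤ j m) → Sat (⋀ as f) → ∀ {a} → a ∈ˡ as → Sat (f a)
  ⋀-elim (b ∷ as) f s (Any.here refl) = proj₁ (∧⊤-elim (f b) (⋀ as f) s)
  ⋀-elim (b ∷ as) f s (Any.there a∈) = ⋀-elim as f (proj₂ (∧⊤-elim (f b) (⋀ as f) s)) a∈

  ⋁-intro : (a₀ : A) (as : List A) (f : A → MSO⊤ j m) → ∀ {a} → a ∈ˡ as → Sat (f a) → Sat (⋁ a₀ as f)
  ⋁-intro a₀ (b ∷ as) f (Any.here refl) s = ∨⊤-introˡ (f b) (⋁ a₀ as f) s
  ⋁-intro a₀ (b ∷ as) f (Any.there a∈) s = ∨⊤-introʳ (f b) (⋁ a₀ as f) (⋁-intro a₀ as f a∈ s)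

  ⋁-elim : (a₀ : A) (as : List A) (f : A → MSO⊤ j m) → Sat (⋁ a₀ as f) → ∃ λ a → Sat (f a)
  ⋁-elim a₀ []       f s = a₀ , s
  ⋁-elim a₀ (b ∷ as) f s with ∨⊤-elim (f b) (⋁ a₀ as f) s
  ... | inj₁ sb = b , sb
  ... | inj₂ sr = ⋁-elim a₀ as f sr

module _ {u : Word} {ρ : Vec (Pos u) j} {σ : Vec (PosSet u) m} where

  ∃⊤-intro : ∀ f (i : Pos u) → Holds (satMSO u (i ∷ ρ) σ) f → Holds (satMSO u ρ σ) (∃⊤ f)
  ∃⊤-intro nothing  i s = tt
  ∃⊤-intro (just φ) i s = i , s

  ∃⊤-elim : ∀ f → Holds (satMSO u ρ σ) (∃⊤ f) → ∃ λ (i : Pos u) → Holds (satMSO u (i ∷ ρ) σ) f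
  ∃⊤-elim nothing  s = zero , tt
  ∃⊤-elim (just φ) s = s

  ∀⊤-intro : ∀ f → (∀ (i : Pos u) → Holds (satMSO u (i ∷ ρ) σ) f) → Holds (satMSO u ρ σ) (∀⊤ f)
  ∀⊤-intro nothing  s = tt
  ∀⊤-intro (just φ) s = s

  ∀⊤-elim : ∀ f → Holds (satMSO u ρ σ) (∀⊤ f) → ∀ (i : Pos u) → Holds (satMSO u (i ∷ ρ) σ) f
  ∀⊤-elim nothing  s i = tt
  ∀⊤-elim (just φ) s   = s

  ∃²⊤-intro : ∀ f (X : PosSet u) → Holds (satMSO u ρ (X ∷ σ)) f → Holds (satMSO u ρ σ) (∃²⊤ f)
  ∃²⊤-intro nothing  X s = tt
  ∃²⊤-intro (just φ) X s = X , s

  ∃²⊤-elim : ∀ f → Holds (satMSO u ρ σ) (∃²⊤ f) → ∃ λ (X : PosSet u) → Holds (satMSO u ρ (X ∷ σ)) f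
  ∃²⊤-elim nothing  s = ∅ , tt
  ∃²⊤-elim (just φ) s = s

  ∀²⊤-intro : ∀ f → (∀ (X : PosSet u) → Holds (satMSO u ρ (X ∷ σ)) f) → Holds (satMSO u ρ σ) (∀²⊤ f)
  ∀²⊤-intro nothing  s = tt
  ∀²⊤-intro (just φ) s = s

  ∀²⊤-elim : ∀ f → Holds (satMSO u ρ σ) (∀²⊤ f) → ∀ (X : PosSet u) → Holds (satMSO u ρ (X ∷ σ)) f
  ∀²⊤-elim nothing  s X = tt
  ∀²⊤-elim (just φ) s   = s

record Within (sets : Bool) (k : ℕ) (φ : MSO j m) : Set where
  constructor _,_
  field
    admissible : Admissible sets φ
    rank≤      : qrMSO φ ≤ k

Within-∧ : ∀ {φ ψ : MSO j m} → Within sets k φ → Within sets k ψ → Within sets k (φ ∧′ ψ)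
Within-∧ (aφ , rφ) (aψ , rψ) = (aφ , aψ) , ⊔-lub rφ rψ

Within-∨ : ∀ {φ ψ : MSO j m} → Within sets k φ → Within sets k ψ → Within sets k (φ ∨′ ψ)
Within-∨ (aφ , rφ) (aψ , rψ) = (aφ , aψ) , ⊔-lub rφ rψ

module _ {sets : Bool} {k : ℕ} where

  ∧⊤-within : (f g : MSO⊤ j m) → Holds (Within sets k) f → Holds (Within sets k) g → Holds (Within sets k) (f ∧⊤ g)
  ∧⊤-within = ∧⊤-closed Within-∧

  ⋀-within : (as : List A) (f : A → MSO⊤ j m) → (∀ a → Holds (Within sets k) (f a)) → Holds (Within sets k) (⋀ as f)
  ⋀-within = ⋀-closed Within-∧

  ⋁-within : (a₀ : A) (as : List A) (f : A → MSO⊤ j m) → (∀ a → Holds (Within sets k) (f a)) →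
    Holds (Within sets k) (⋁ a₀ as f)
  ⋁-within = ⋁-closed Within-∨

  Within-∃⊤ : (f : MSO⊤ (suc j) m) → Holds (Within sets k) f → Holds (Within sets (suc k)) (∃⊤ f)
  Within-∃⊤ nothing  _         = tt
  Within-∃⊤ (just φ) (a , r≤k) = a , s≤s r≤k

  Within-∀⊤ : (f : MSO⊤ (suc j) m) → Holds (Within sets k) f → Holds (Within sets (suc k)) (∀⊤ f)
  Within-∀⊤ nothing  _         = tt
  Within-∀⊤ (just φ) (a , r≤k) = a , s≤s r≤k

  Within-∃²⊤ : T sets → (f : MSO⊤ j (suc m)) → Holds (Within sets k) f → Holds (Within sets (suc k)) (∃²⊤ f)
  Within-∃²⊤ s nothing  _         = tt
  Within-∃²⊤ s (just φ) (a , r≤k) = (s , a) , s≤s r≤k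

  Within-∀²⊤ : T sets → (f : MSO⊤ j (suc m)) → Holds (Within sets k) f → Holds (Within sets (suc k)) (∀²⊤ f)
  Within-∀²⊤ s nothing  _         = tt
  Within-∀²⊤ s (just φ) (a , r≤k) = (s , a) , s≤s r≤k

_≟ᴸ_ : (a b : Letter) → Dec (a ≡ b)
l ≟ᴸ l = yes refl
l ≟ᴸ r = no λ ()
r ≟ᴸ l = no λ ()
r ≟ᴸ r = yes refl

letter-ext : ∀ {a b : Letter} → (a ≡ l) ⇔ (b ≡ l) → a ≡ b
letter-ext {l} {l} _ = refl
letter-ext {l} {r} e = sym (to e refl)
letter-ext {r} {l} e = from e refl
letter-ext {r} {r} _ = refl

bool-ext : ∀ {a b : Bool} → (a ≡ true) ⇔ (b ≡ true) → a ≡ b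
bool-ext {true}  {true}  _ = refl
bool-ext {true}  {false} e = sym (to e refl)
bool-ext {false} {true}  e = from e refl
bool-ext {false} {false} _ = refl

total-PartialIso : ∀ {u v} (ρ : Vec (Pos u) j) (σ : Vec (PosSet u) m) (ρ′ : Vec (Pos v) j) (σ′ : Vec (PosSet v) m) →
  (∀ x → letterAt u (lookup ρ x) ≡ letterAt v (lookup ρ′ x)) →
  (∀ x y → compare (toℕ (lookup ρ x)) (toℕ (lookup ρ y)) ≡ compare (toℕ (lookup ρ′ x)) (toℕ (lookup ρ′ y))) →
  (∀ x X → lookup (lookup σ X) (lookup ρ x) ≡ lookup (lookup σ′ X) (lookup ρ′ x)) →
  PartialIso u (Vec.map just ρ) (Vec.map just σ) v (Vec.map just ρ′) (Vec.map just σ′)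
total-PartialIso {u = u} {v} ρ σ ρ′ σ′ letter≡ order≡ member≡ =
  record { letter = letter′ ; order = order′ ; member = member′ }
  where
  letter′ : ∀ x → letterOf u (lookup (Vec.map just ρ) x) ≡ letterOf v (lookup (Vec.map just ρ′) x)
  letter′ x rewrite lookup-map x just ρ | lookup-map x just ρ′ = cong just (letter≡ x)
  order′ : ∀ x y → orderOf (lookup (Vec.map just ρ) x) (lookup (Vec.map just ρ) y)
                 ≡ orderOf (lookup (Vec.map just ρ′) x) (lookup (Vec.map just ρ′) y)
  order′ x y rewrite lookup-map x just ρ | lookup-map y just ρ | lookup-map x just ρ′ | lookup-map y just ρ′ =
    cong just (order≡ x y)
  member′ : ∀ x X → memberOf (lookup (Vec.map just ρ) x) (lookup (Vec.map just σ) X)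
                  ≡ memberOf (lookup (Vec.map just ρ′) x) (lookup (Vec.map just σ′) X)
  member′ x X rewrite lookup-map x just ρ | lookup-map X just σ | lookup-map x just ρ′ | lookup-map X just σ′ =
    cong just (member≡ x X)

literal : Dec A → MSO j m → MSO j m
literal (yes _) α = α
literal (no _)  α = ¬′ α

module Literal (u : Word) (ρ : Vec (Pos u) j) (σ : Vec (PosSet u) m) (α : MSO j m) where

  literal-holds : (d : Dec (satMSO u ρ σ α)) → satMSO u ρ σ (literal d α)
  literal-holds (yes s) = s
  literal-holds (no ¬s) = ¬s

  literal-⇔ : ∀ {v ρ′ σ′} (d : Dec (satMSO u ρ σ α)) → satMSO v ρ′ σ′ (literal d α) →
    satMSO u ρ σ α ⇔ satMSO v ρ′ σ′ α
  literal-⇔ (yes s) s′  = mk⇔ (λ _ → s′) (λ _ → s)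
  literal-⇔ (no ¬s) ¬s′ = mk⇔ (λ s → ⊥-elim (¬s s)) (λ s′ → ⊥-elim (¬s′ s′))

literal-within : ∀ (α : MSO j m) (d : Dec A) → Admissible sets α → qrMSO α ≡ 0 → Within sets k (literal d α)
literal-within α (yes _) a r≡0 = a , ≤-trans (≤-reflexive r≡0) z≤n
literal-within α (no _)  a r≡0 = a , ≤-trans (≤-reflexive r≡0) z≤n

module AtomicType (u : Word) (ρ : Vec (Pos u) j) (σ : Vec (PosSet u) m) where

  open Literal u ρ σ

  letter? : ∀ x → Dec (satMSO u ρ σ (Pl x))
  letter? x = letterAt u (lookup ρ x) ≟ᴸ l

  less? : ∀ x y → Dec (satMSO u ρ σ (x <′ y))
  less? x y = lookup ρ x <ᶠ? lookup ρ y

  equal? : ∀ x y → Dec (satMSO u ρ σ (x ≐ y))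
  equal? x y = lookup ρ x ≟ᶠ lookup ρ y

  member? : ∀ x X → Dec (satMSO u ρ σ (x ∈′ X))
  member? x X = lookup (lookup σ X) (lookup ρ x) ≟ᵇ true

  fact : (α : MSO j m) → Dec (satMSO u ρ σ α) → MSO⊤ j m
  fact α d = just (literal d α)

  -- Over {l, r} the literal for Pl x already fixes the letter, so Pr needs no literal.
  letterFact : Fin j → MSO⊤ j m
  letterFact x = fact (Pl x) (letter? x)

  orderFact : Fin j → Fin j → MSO⊤ j m
  orderFact x y = fact (x <′ y) (less? x y) ∧⊤ fact (x ≐ y) (equal? x y)

  orderFacts : Fin j → MSO⊤ j m
  orderFacts x = ⋀ (allFin j) (orderFact x)

  memberFact : Fin j → Fin m → MSO⊤ j m
  memberFact x X = fact (x ∈′ X) (member? x X)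

  memberFacts : Fin j → MSO⊤ j m
  memberFacts x = ⋀ (allFin m) (memberFact x)

  factsAbout : Fin j → MSO⊤ j m
  factsAbout x = letterFact x ∧⊤ orderFacts x ∧⊤ memberFacts x

  atomicType : MSO⊤ j m
  atomicType = ⋀ (allFin j) factsAbout

  atomicType-holds : Holds (satMSO u ρ σ) atomicType
  atomicType-holds = ⋀-intro (allFin j) factsAbout λ x →
    ∧⊤-intro (letterFact x) (orderFacts x ∧⊤ memberFacts x) (literal-holds (Pl x) (letter? x))
      (∧⊤-intro (orderFacts x) (memberFacts x)
        (⋀-intro (allFin j) (orderFact x) λ y → ∧⊤-intro (fact (x <′ y) (less? x y)) (fact (x ≐ y) (equal? x y))
                                              (literal-holds (x <′ y) (less? x y)) (literal-holds (x ≐ y) (equal? x y)))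
        (⋀-intro (allFin m) (memberFact x) λ X → literal-holds (x ∈′ X) (member? x X)))

  atomicType-within : Holds (Within sets k) atomicType
  atomicType-within = ⋀-within (allFin j) factsAbout λ x →
    ∧⊤-within (letterFact x) (orderFacts x ∧⊤ memberFacts x) (literal-within (Pl x) (letter? x) tt refl)
      (∧⊤-within (orderFacts x) (memberFacts x)
        (⋀-within (allFin j) (orderFact x) λ y →
          ∧⊤-within (fact (x <′ y) (less? x y)) (fact (x ≐ y) (equal? x y))
                    (literal-within (x <′ y) (less? x y) tt refl) (literal-within (x ≐ y) (equal? x y) tt refl))
        (⋀-within (allFin m) (memberFact x) λ X → literal-within (x ∈′ X) (member? x X) tt refl))

  atomicType⇒PartialIso : ∀ {v} {ρ′ : Vec (Pos v) j} {σ′ : Vec (PosSet v) m} →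
    Holds (satMSO v ρ′ σ′) atomicType →
    PartialIso u (Vec.map just ρ) (Vec.map just σ) v (Vec.map just ρ′) (Vec.map just σ′)
  atomicType⇒PartialIso {v} {ρ′} {σ′} s = total-PartialIso ρ σ ρ′ σ′ letter≡ order≡ member≡
    where
    facts : ∀ x → Holds (satMSO v ρ′ σ′) (letterFact x) × Holds (satMSO v ρ′ σ′) (orderFacts x ∧⊤ memberFacts x)
    facts x = ∧⊤-elim (letterFact x) (orderFacts x ∧⊤ memberFacts x) (⋀-elim (allFin j) factsAbout s (∈-allFin x))
    letter≡ : ∀ x → letterAt u (lookup ρ x) ≡ letterAt v (lookup ρ′ x)
    letter≡ x = letter-ext (literal-⇔ (Pl x) (letter? x) (proj₁ (facts x)))
    order≡ : ∀ x y → compare (toℕ (lookup ρ x)) (toℕ (lookup ρ y))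
                   ≡ compare (toℕ (lookup ρ′ x)) (toℕ (lookup ρ′ y))
    order≡ x y = compare-cong (literal-⇔ (x <′ y) (less? x y) (proj₁ xy))
                              (⇔.trans (⇔.sym toℕ-⇔) (⇔.trans (literal-⇔ (x ≐ y) (equal? x y) (proj₂ xy)) toℕ-⇔))
      where
      xy : Holds (satMSO v ρ′ σ′) (fact (x <′ y) (less? x y)) × Holds (satMSO v ρ′ σ′) (fact (x ≐ y) (equal? x y))
      xy = ∧⊤-elim (fact (x <′ y) (less? x y)) (fact (x ≐ y) (equal? x y))
             (⋀-elim (allFin j) (orderFact x) (proj₁ (∧⊤-elim (orderFacts x) (memberFacts x) (proj₂ (facts x)))) (∈-allFin y))
    member≡ : ∀ x X → lookup (lookup σ X) (lookup ρ x) ≡ lookup (lookup σ′ X) (lookup ρ′ x)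
    member≡ x X = bool-ext (literal-⇔ (x ∈′ X) (member? x X)
      (⋀-elim (allFin m) (memberFact x) (proj₂ (∧⊤-elim (orderFacts x) (memberFacts x) (proj₂ (facts x)))) (∈-allFin X)))

open AtomicType using (atomicType; atomicType-holds; atomicType-within; atomicType⇒PartialIso)

allSubsets : ∀ n → List (Subset n)
allSubsets zero    = [] ∷ []
allSubsets (suc n) = List.map (inside ∷_) (allSubsets n) ++ List.map (outside ∷_) (allSubsets n)

∈-allSubsets : ∀ (p : Subset n) → p ∈ˡ allSubsets n
∈-allSubsets []                  = Any.here refl
∈-allSubsets (true ∷ p)          = ∈-++⁺ˡ (∈-map⁺ (inside ∷_) (∈-allSubsets p))
∈-allSubsets {suc n} (false ∷ p) = ∈-++⁺ʳ (List.map (inside ∷_) (allSubsets n)) (∈-map⁺ (outside ∷_) (∈-allSubsets p))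

pointMoves : (u : Word) → (Pos u → MSO⊤ (suc j) m) → MSO⊤ j m
pointMoves u next = ⋀ (allFin ∣ u ∣) (λ i → ∃⊤ (next i)) ∧⊤ ∀⊤ (⋁ zero (allFin ∣ u ∣) next)

setMoves : (u : Word) → (PosSet u → MSO⊤ j (suc m)) → MSO⊤ j m
setMoves u next = ⋀ (allSubsets ∣ u ∣) (λ X → ∃²⊤ (next X)) ∧⊤ ∀²⊤ (⋁ ∅ (allSubsets ∣ u ∣) next)

when : Bool → MSO⊤ j m → MSO⊤ j m
when true  f = f
when false f = nothing

when-intro : ∀ {P : MSO j m → Set} sets f → (T sets → Holds P f) → Holds P (when sets f)
when-intro true  f h = h tt
when-intro false f h = tt

when-elim : ∀ {P : MSO j m → Set} sets f → Holds P (when sets f) → T sets → Holds P f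
when-elim true f h _ = h

module _ {u : Word} {ρ : Vec (Pos u) j} {σ : Vec (PosSet u) m} where

  pointMoves-holds : (next : Pos u → MSO⊤ (suc j) m) → (∀ i → Holds (satMSO u (i ∷ ρ) σ) (next i)) →
    Holds (satMSO u ρ σ) (pointMoves u next)
  pointMoves-holds next h =
    ∧⊤-intro (⋀ (allFin ∣ u ∣) (λ i → ∃⊤ (next i))) (∀⊤ (⋁ zero (allFin ∣ u ∣) next))
      (⋀-intro (allFin ∣ u ∣) (λ i → ∃⊤ (next i)) λ i → ∃⊤-intro (next i) i (h i))
      (∀⊤-intro (⋁ zero (allFin ∣ u ∣) next) λ i → ⋁-intro zero (allFin ∣ u ∣) next (∈-allFin i) (h i))

  setMoves-holds : (next : PosSet u → MSO⊤ j (suc m)) → (∀ X → Holds (satMSO u ρ (X ∷ σ)) (next X)) →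
    Holds (satMSO u ρ σ) (setMoves u next)
  setMoves-holds next h =
    ∧⊤-intro (⋀ (allSubsets ∣ u ∣) (λ X → ∃²⊤ (next X))) (∀²⊤ (⋁ ∅ (allSubsets ∣ u ∣) next))
      (⋀-intro (allSubsets ∣ u ∣) (λ X → ∃²⊤ (next X)) λ X → ∃²⊤-intro (next X) X (h X))
      (∀²⊤-intro (⋁ ∅ (allSubsets ∣ u ∣) next) λ X → ⋁-intro ∅ (allSubsets ∣ u ∣) next (∈-allSubsets X) (h X))

module _ {u v : Word} {ρ′ : Vec (Pos v) j} {σ′ : Vec (PosSet v) m} where

  pointMoves-elim : (next : Pos u → MSO⊤ (suc j) m) → Holds (satMSO v ρ′ σ′) (pointMoves u next) →
    BackAndForth (λ (i : Pos u) (i′ : Pos v) → Holds (satMSO v (i′ ∷ ρ′) σ′) (next i))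
  pointMoves-elim next h with ∧⊤-elim (⋀ (allFin ∣ u ∣) (λ i → ∃⊤ (next i))) (∀⊤ (⋁ zero (allFin ∣ u ∣) next)) h
  ... | forth , back =
    (λ i → ∃⊤-elim (next i) (⋀-elim (allFin ∣ u ∣) (λ i → ∃⊤ (next i)) forth (∈-allFin i))) ,
    (λ i′ → ⋁-elim zero (allFin ∣ u ∣) next (∀⊤-elim (⋁ zero (allFin ∣ u ∣) next) back i′))

  setMoves-elim : (next : PosSet u → MSO⊤ j (suc m)) → Holds (satMSO v ρ′ σ′) (setMoves u next) →
    BackAndForth (λ (X : PosSet u) (Y : PosSet v) → Holds (satMSO v ρ′ (Y ∷ σ′)) (next X))
  setMoves-elim next h
    with ∧⊤-elim (⋀ (allSubsets ∣ u ∣) (λ X → ∃²⊤ (next X))) (∀²⊤ (⋁ ∅ (allSubsets ∣ u ∣) next)) h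
  ... | forth , back =
    (λ X → ∃²⊤-elim (next X) (⋀-elim (allSubsets ∣ u ∣) (λ X → ∃²⊤ (next X)) forth (∈-allSubsets X))) ,
    (λ Y → ⋁-elim ∅ (allSubsets ∣ u ∣) next (∀²⊤-elim (⋁ ∅ (allSubsets ∣ u ∣) next) back Y))

module _ {sets : Bool} {k : ℕ} where

  pointMoves-within : (u : Word) (next : Pos u → MSO⊤ (suc j) m) → (∀ i → Holds (Within sets k) (next i)) →
    Holds (Within sets (suc k)) (pointMoves u next)
  pointMoves-within u next h =
    ∧⊤-within (⋀ (allFin ∣ u ∣) (λ i → ∃⊤ (next i))) (∀⊤ (⋁ zero (allFin ∣ u ∣) next))
      (⋀-within (allFin ∣ u ∣) (λ i → ∃⊤ (next i)) λ i → Within-∃⊤ (next i) (h i))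
      (Within-∀⊤ (⋁ zero (allFin ∣ u ∣) next) (⋁-within zero (allFin ∣ u ∣) next h))

  setMoves-within : T sets → (u : Word) (next : PosSet u → MSO⊤ j (suc m)) → (∀ X → Holds (Within sets k) (next X)) →
    Holds (Within sets (suc k)) (setMoves u next)
  setMoves-within s u next h =
    ∧⊤-within (⋀ (allSubsets ∣ u ∣) (λ X → ∃²⊤ (next X))) (∀²⊤ (⋁ ∅ (allSubsets ∣ u ∣) next))
      (⋀-within (allSubsets ∣ u ∣) (λ X → ∃²⊤ (next X)) λ X → Within-∃²⊤ s (next X) (h X))
      (Within-∀²⊤ s (⋁ ∅ (allSubsets ∣ u ∣) next) (⋁-within ∅ (allSubsets ∣ u ∣) next h))

hintikka : Bool → ℕ → (u : Word) → Vec (Pos u) j → Vec (PosSet u) m → MSO⊤ j m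
hintikka sets zero    u ρ σ = atomicType u ρ σ
hintikka sets (suc k) u ρ σ =
  atomicType u ρ σ ∧⊤ pointMoves u (λ i → hintikka sets k u (i ∷ ρ) σ)
                   ∧⊤ when sets (setMoves u (λ X → hintikka sets k u ρ (X ∷ σ)))

hintikka-holds : ∀ sets k u (ρ : Vec (Pos u) j) (σ : Vec (PosSet u) m) → Holds (satMSO u ρ σ) (hintikka sets k u ρ σ)
hintikka-holds sets zero    u ρ σ = atomicType-holds u ρ σ
hintikka-holds {j} {m} sets (suc k) u ρ σ =
  ∧⊤-intro (atomicType u ρ σ) (pointMoves u nextPoint ∧⊤ when sets (setMoves u nextSet)) (atomicType-holds u ρ σ)
    (∧⊤-intro (pointMoves u nextPoint) (when sets (setMoves u nextSet))
      (pointMoves-holds {u = u} {ρ} {σ} nextPoint λ i → hintikka-holds sets k u (i ∷ ρ) σ)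
      (when-intro sets (setMoves u nextSet) λ _ →
        setMoves-holds {u = u} {ρ} {σ} nextSet λ X → hintikka-holds sets k u ρ (X ∷ σ)))
  where
  nextPoint : Pos u → MSO⊤ (suc j) m
  nextPoint i = hintikka sets k u (i ∷ ρ) σ
  nextSet : PosSet u → MSO⊤ j (suc m)
  nextSet X = hintikka sets k u ρ (X ∷ σ)

hintikka-within : ∀ sets k u (ρ : Vec (Pos u) j) (σ : Vec (PosSet u) m) → Holds (Within sets k) (hintikka sets k u ρ σ)
hintikka-within sets zero    u ρ σ = atomicType-within u ρ σ
hintikka-within {j} {m} sets (suc k) u ρ σ =
  ∧⊤-within (atomicType u ρ σ) (pointMoves u nextPoint ∧⊤ when sets (setMoves u nextSet)) (atomicType-within u ρ σ)
    (∧⊤-within (pointMoves u nextPoint) (when sets (setMoves u nextSet))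
      (pointMoves-within u nextPoint λ i → hintikka-within sets k u (i ∷ ρ) σ)
      (when-intro sets (setMoves u nextSet) λ s → setMoves-within s u nextSet λ X → hintikka-within sets k u ρ (X ∷ σ)))
  where
  nextPoint : Pos u → MSO⊤ (suc j) m
  nextPoint i = hintikka sets k u (i ∷ ρ) σ
  nextSet : PosSet u → MSO⊤ j (suc m)
  nextSet X = hintikka sets k u ρ (X ∷ σ)

hintikka-wins : ∀ sets k u (ρ : Vec (Pos u) j) (σ : Vec (PosSet u) m) {v} {ρ′ : Vec (Pos v) j} {σ′ : Vec (PosSet v) m} →
  Holds (satMSO v ρ′ σ′) (hintikka sets k u ρ σ) →
  Wins sets k u (Vec.map just ρ) (Vec.map just σ) v (Vec.map just ρ′) (Vec.map just σ′)
hintikka-wins sets zero    u ρ σ h = done (atomicType⇒PartialIso u ρ σ h)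
hintikka-wins {j} {m} sets (suc k) u ρ σ {v} {ρ′} {σ′} h =
  round (atomicType⇒PartialIso u ρ σ (proj₁ parts))
        (map-BackAndForth (λ {i} → hintikka-wins sets k u (i ∷ ρ) σ)
                          (pointMoves-elim {u = u} {v} {ρ′} {σ′} nextPoint (proj₁ moves)))
        (λ s → map-BackAndForth (λ {X} → hintikka-wins sets k u ρ (X ∷ σ))
                                (setMoves-elim {u = u} {v} {ρ′} {σ′} nextSet
                                   (when-elim sets (setMoves u nextSet) (proj₂ moves) s)))
  where
  Sat : MSO⊤ j m → Set
  Sat = Holds (satMSO v ρ′ σ′)
  nextPoint : Pos u → MSO⊤ (suc j) m
  nextPoint i = hintikka sets k u (i ∷ ρ) σ
  nextSet : PosSet u → MSO⊤ j (suc m)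
  nextSet X = hintikka sets k u ρ (X ∷ σ)
  parts : Sat (atomicType u ρ σ) × Sat (pointMoves u nextPoint ∧⊤ when sets (setMoves u nextSet))
  parts = ∧⊤-elim (atomicType u ρ σ) (pointMoves u nextPoint ∧⊤ when sets (setMoves u nextSet)) h
  moves : Sat (pointMoves u nextPoint) × Sat (when sets (setMoves u nextSet))
  moves = ∧⊤-elim (pointMoves u nextPoint) (when sets (setMoves u nextSet)) (proj₂ parts)

-- Concatenation

inl : (xs ys : List A) → Fin (List.length xs) → Fin (List.length (xs ++ ys))
inl (x ∷ xs) ys zero    = zero
inl (x ∷ xs) ys (suc i) = suc (inl xs ys i)

inr : (xs ys : List A) → Fin (List.length ys) → Fin (List.length (xs ++ ys))
inr []       ys i = i
inr (x ∷ xs) ys i = suc (inr xs ys i)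

split : (xs ys : List A) → Fin (List.length (xs ++ ys)) → Fin (List.length xs) ⊎ Fin (List.length ys)
split []       ys p       = inj₂ p
split (x ∷ xs) ys zero    = inj₁ zero
split (x ∷ xs) ys (suc p) = Data.Sum.map₁ suc (split xs ys p)

data SplitView (xs ys : List A) : Fin (List.length (xs ++ ys)) → Set where
  left  : ∀ i → SplitView xs ys (inl xs ys i)
  right : ∀ i → SplitView xs ys (inr xs ys i)

splitView : (xs ys : List A) (p : Fin (List.length (xs ++ ys))) → SplitView xs ys p
splitView []       ys p    = right p
splitView (x ∷ xs) ys zero = left zero
splitView (x ∷ xs) ys (suc p) with splitView xs ys p
... | left i  = left (suc i)
... | right i = right i

split-inl : (xs ys : List A) (i : Fin (List.length xs)) → split xs ys (inl xs ys i) ≡ inj₁ i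
split-inl (x ∷ xs) ys zero    = refl
split-inl (x ∷ xs) ys (suc i) = cong (Data.Sum.map₁ suc) (split-inl xs ys i)

split-inr : (xs ys : List A) (i : Fin (List.length ys)) → split xs ys (inr xs ys i) ≡ inj₂ i
split-inr []       ys i = refl
split-inr (x ∷ xs) ys i = cong (Data.Sum.map₁ suc) (split-inr xs ys i)

toℕ-inl : (xs ys : List A) (i : Fin (List.length xs)) → toℕ (inl xs ys i) ≡ toℕ i
toℕ-inl (x ∷ xs) ys zero    = refl
toℕ-inl (x ∷ xs) ys (suc i) = cong suc (toℕ-inl xs ys i)

toℕ-inr : (xs ys : List A) (i : Fin (List.length ys)) → toℕ (inr xs ys i) ≡ List.length xs + toℕ i
toℕ-inr []       ys i = refl
toℕ-inr (x ∷ xs) ys i = cong suc (toℕ-inr xs ys i)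

lookup-inl : (xs ys : List A) (i : Fin (List.length xs)) → List.lookup (xs ++ ys) (inl xs ys i) ≡ List.lookup xs i
lookup-inl (x ∷ xs) ys zero    = refl
lookup-inl (x ∷ xs) ys (suc i) = lookup-inl xs ys i

lookup-inr : (xs ys : List A) (i : Fin (List.length ys)) → List.lookup (xs ++ ys) (inr xs ys i) ≡ List.lookup ys i
lookup-inr []       ys i = refl
lookup-inr (x ∷ xs) ys i = lookup-inr xs ys i

restrictˡ : (xs ys : List A) → Subset (List.length (xs ++ ys)) → Subset (List.length xs)
restrictˡ []       ys X       = []
restrictˡ (x ∷ xs) ys (s ∷ X) = s ∷ restrictˡ xs ys X

restrictʳ : (xs ys : List A) → Subset (List.length (xs ++ ys)) → Subset (List.length ys)
restrictʳ []       ys X       = X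
restrictʳ (x ∷ xs) ys (s ∷ X) = restrictʳ xs ys X

glue : (xs ys : List A) → Subset (List.length xs) → Subset (List.length ys) → Subset (List.length (xs ++ ys))
glue []       ys []      Z = Z
glue (x ∷ xs) ys (s ∷ Y) Z = s ∷ glue xs ys Y Z

lookup-restrictˡ : (xs ys : List A) → ∀ X i → lookup (restrictˡ xs ys X) i ≡ lookup X (inl xs ys i)
lookup-restrictˡ (x ∷ xs) ys (s ∷ X) zero    = refl
lookup-restrictˡ (x ∷ xs) ys (s ∷ X) (suc i) = lookup-restrictˡ xs ys X i

lookup-restrictʳ : (xs ys : List A) → ∀ X i → lookup (restrictʳ xs ys X) i ≡ lookup X (inr xs ys i)
lookup-restrictʳ []       ys X       i = refl
lookup-restrictʳ (x ∷ xs) ys (s ∷ X) i = lookup-restrictʳ xs ys X i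

restrictˡ-glue : (xs ys : List A) → ∀ Y Z → restrictˡ xs ys (glue xs ys Y Z) ≡ Y
restrictˡ-glue []       ys []      Z = refl
restrictˡ-glue (x ∷ xs) ys (s ∷ Y) Z = cong (s ∷_) (restrictˡ-glue xs ys Y Z)

restrictʳ-glue : (xs ys : List A) → ∀ Y Z → restrictʳ xs ys (glue xs ys Y Z) ≡ Z
restrictʳ-glue []       ys []      Z = refl
restrictʳ-glue (x ∷ xs) ys (s ∷ Y) Z = restrictʳ-glue xs ys Y Z

-- Compares positions lying in the left (true) or right (false) factor of a concatenation;
-- same-factor pairs are decided by the factor codes, so the value equal is never used.
crossOrder : Bool → Bool → Comparison
crossOrder true  false = less
crossOrder false true  = greater
crossOrder _     _     = equal

module Concatenation (a b : Word) where

  xs ys : List Letter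
  xs = toList a
  ys = toList b

  ab : Word
  ab = a ⁺++⁺ b

  projˡ : Maybe (Pos ab) → Maybe (Pos a)
  projˡ nothing  = nothing
  projˡ (just p) = [ just , (λ _ → nothing) ]′ (split xs ys p)

  projʳ : Maybe (Pos ab) → Maybe (Pos b)
  projʳ nothing  = nothing
  projʳ (just p) = [ (λ _ → nothing) , just ]′ (split xs ys p)

  envˡ : Env ab j → Env a j
  envˡ = Vec.map projˡ

  envʳ : Env ab j → Env b j
  envʳ = Vec.map projʳ

  setEnvˡ : SetEnv ab m → SetEnv a m
  setEnvˡ = Vec.map (Maybe.map (restrictˡ xs ys))

  setEnvʳ : SetEnv ab m → SetEnv b m
  setEnvʳ = Vec.map (Maybe.map (restrictʳ xs ys))

  envˡ-inl : ∀ i (ρ : Env ab j) → just i ∷ envˡ ρ ≡ envˡ (just (inl xs ys i) ∷ ρ)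
  envˡ-inl i ρ = cong (λ p → [ just , (λ _ → nothing) ]′ p ∷ envˡ ρ) (sym (split-inl xs ys i))

  envʳ-inl : ∀ i (ρ : Env ab j) → nothing ∷ envʳ ρ ≡ envʳ (just (inl xs ys i) ∷ ρ)
  envʳ-inl i ρ = cong (λ p → [ (λ _ → nothing) , just ]′ p ∷ envʳ ρ) (sym (split-inl xs ys i))

  envˡ-inr : ∀ i (ρ : Env ab j) → nothing ∷ envˡ ρ ≡ envˡ (just (inr xs ys i) ∷ ρ)
  envˡ-inr i ρ = cong (λ p → [ just , (λ _ → nothing) ]′ p ∷ envˡ ρ) (sym (split-inr xs ys i))

  envʳ-inr : ∀ i (ρ : Env ab j) → just i ∷ envʳ ρ ≡ envʳ (just (inr xs ys i) ∷ ρ)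
  envʳ-inr i ρ = cong (λ p → [ (λ _ → nothing) , just ]′ p ∷ envʳ ρ) (sym (split-inr xs ys i))

  setEnvˡ-glue : ∀ X Y (σ : SetEnv ab m) → just X ∷ setEnvˡ σ ≡ setEnvˡ (just (glue xs ys X Y) ∷ σ)
  setEnvˡ-glue X Y σ = cong (λ X′ → just X′ ∷ setEnvˡ σ) (sym (restrictˡ-glue xs ys X Y))

  setEnvʳ-glue : ∀ X Y (σ : SetEnv ab m) → just Y ∷ setEnvʳ σ ≡ setEnvʳ (just (glue xs ys X Y) ∷ σ)
  setEnvʳ-glue X Y σ = cong (λ Y′ → just Y′ ∷ setEnvʳ σ) (sym (restrictʳ-glue xs ys X Y))

  inl<inr : ∀ i i′ → toℕ (inl xs ys i) < toℕ (inr xs ys i′)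
  inl<inr i i′ rewrite toℕ-inl xs ys i | toℕ-inr xs ys i′ = <-≤-trans (toℕ<n i) (m≤m+n _ _)

  letter-split : ∀ p → letterOf ab p ≡ letterOf a (projˡ p) <∣> letterOf b (projʳ p)
  letter-split nothing = refl
  letter-split (just p) with splitView xs ys p
  ... | left i  rewrite split-inl xs ys i = cong just (lookup-inl xs ys i)
  ... | right i rewrite split-inr xs ys i = cong just (lookup-inr xs ys i)

  member-split : ∀ p X → memberOf p X ≡ memberOf (projˡ p) (Maybe.map (restrictˡ xs ys) X)
                                       <∣> memberOf (projʳ p) (Maybe.map (restrictʳ xs ys) X)
  member-split nothing  X = refl
  member-split (just p) X with splitView xs ys p
  member-split (just p) nothing  | left i  rewrite split-inl xs ys i = refl
  member-split (just p) (just Y) | left i  rewrite split-inl xs ys i = cong just (sym (lookup-restrictˡ xs ys Y i))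
  member-split (just p) nothing  | right i rewrite split-inr xs ys i = refl
  member-split (just p) (just Y) | right i rewrite split-inr xs ys i = cong just (sym (lookup-restrictʳ xs ys Y i))

  -- Read off the letter codes, so that partial isomorphisms of the factors preserve it.
  sideOf : Maybe (Pos ab) → Maybe Bool
  sideOf p = Maybe.map (λ _ → true) (letterOf a (projˡ p)) <∣> Maybe.map (λ _ → false) (letterOf b (projʳ p))

  order-split : ∀ p q → orderOf p q ≡ orderOf (projˡ p) (projˡ q) <∣> orderOf (projʳ p) (projʳ q)
                                      <∣> Maybe.zipWith crossOrder (sideOf p) (sideOf q)
  order-split nothing  q = refl
  order-split (just p) q with splitView xs ys p
  order-split (just p) nothing | left i  rewrite split-inl xs ys i = refl
  order-split (just p) nothing | right i rewrite split-inr xs ys i = refl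
  order-split (just p) (just q) | left i with splitView xs ys q
  ... | left i′ rewrite split-inl xs ys i | split-inl xs ys i′ =
    cong just (cong₂ compare (toℕ-inl xs ys i) (toℕ-inl xs ys i′))
  ... | right i′ rewrite split-inl xs ys i | split-inr xs ys i′ =
    cong just (<⇒compare≡less (inl<inr i i′))
  order-split (just p) (just q) | right i with splitView xs ys q
  ... | left i′ rewrite split-inr xs ys i | split-inl xs ys i′ =
    cong just (>⇒compare≡greater (inl<inr i′ i))
  ... | right i′ rewrite split-inr xs ys i | split-inr xs ys i′ =
    cong just (trans (cong₂ compare (toℕ-inr xs ys i) (toℕ-inr xs ys i′)) (compare-+ (List.length xs) _ _))

  sideAt : Env ab j → Fin j → Maybe Bool
  sideAt ρ x = Maybe.map (λ _ → true) (letterOf a (lookup (envˡ ρ) x))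
           <∣> Maybe.map (λ _ → false) (letterOf b (lookup (envʳ ρ) x))

  letter-env : ∀ (ρ : Env ab j) x →
    letterOf ab (lookup ρ x) ≡ letterOf a (lookup (envˡ ρ) x) <∣> letterOf b (lookup (envʳ ρ) x)
  letter-env ρ x rewrite lookup-map x projˡ ρ | lookup-map x projʳ ρ = letter-split (lookup ρ x)

  member-env : ∀ (ρ : Env ab j) (σ : SetEnv ab m) x X →
    memberOf (lookup ρ x) (lookup σ X) ≡ memberOf (lookup (envˡ ρ) x) (lookup (setEnvˡ σ) X)
                                      <∣> memberOf (lookup (envʳ ρ) x) (lookup (setEnvʳ σ) X)
  member-env ρ σ x X
    rewrite lookup-map x projˡ ρ | lookup-map x projʳ ρ
          | lookup-map X (Maybe.map (restrictˡ xs ys)) σ | lookup-map X (Maybe.map (restrictʳ xs ys)) σ =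
    member-split (lookup ρ x) (lookup σ X)

  order-env : ∀ (ρ : Env ab j) x y →
    orderOf (lookup ρ x) (lookup ρ y) ≡ orderOf (lookup (envˡ ρ) x) (lookup (envˡ ρ) y)
                                    <∣> orderOf (lookup (envʳ ρ) x) (lookup (envʳ ρ) y)
                                    <∣> Maybe.zipWith crossOrder (sideAt ρ x) (sideAt ρ y)
  order-env ρ x y
    rewrite lookup-map x projˡ ρ | lookup-map x projʳ ρ | lookup-map y projˡ ρ | lookup-map y projʳ ρ =
    order-split (lookup ρ x) (lookup ρ y)

Wins-cast : ∀ {u v} {ρ₁ ρ₂ : Env u j} {σ₁ σ₂ : SetEnv u m} {ρ₁′ ρ₂′ : Env v j} {σ₁′ σ₂′ : SetEnv v m} →
  ρ₁ ≡ ρ₂ → σ₁ ≡ σ₂ → ρ₁′ ≡ ρ₂′ → σ₁′ ≡ σ₂′ →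
  Wins sets k u ρ₁ σ₁ v ρ₁′ σ₁′ → Wins sets k u ρ₂ σ₂ v ρ₂′ σ₂′
Wins-cast refl refl refl refl w = w

module Composition (a b a′ b′ : Word) where
  open Concatenation a b
  module Cat′ = Concatenation a′ b′

  PartialIso-++ : ∀ {ρ : Env ab j} {σ : SetEnv ab m} {ρ′ σ′} →
    PartialIso a (envˡ ρ) (setEnvˡ σ) a′ (Cat′.envˡ ρ′) (Cat′.setEnvˡ σ′) →
    PartialIso b (envʳ ρ) (setEnvʳ σ) b′ (Cat′.envʳ ρ′) (Cat′.setEnvʳ σ′) →
    PartialIso ab ρ σ Cat′.ab ρ′ σ′
  PartialIso-++ {ρ = ρ} {σ} {ρ′} {σ′} isoˡ isoʳ = record
    { letter = λ x → trans (letter-env ρ x)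
                         (trans (cong₂ _<∣>_ (letter isoˡ x) (letter isoʳ x)) (sym (Cat′.letter-env ρ′ x)))
    ; order  = λ x y → trans (order-env ρ x y)
                         (trans (cong₂ _<∣>_ (order isoˡ x y)
                                  (cong₂ _<∣>_ (order isoʳ x y) (cong₂ (Maybe.zipWith crossOrder) (side x) (side y))))
                                (sym (Cat′.order-env ρ′ x y)))
    ; member = λ x X → trans (member-env ρ σ x X)
                         (trans (cong₂ _<∣>_ (member isoˡ x X) (member isoʳ x X)) (sym (Cat′.member-env ρ′ σ′ x X)))
    }
    where
    side : ∀ x → sideAt ρ x ≡ Cat′.sideAt ρ′ x
    side x = cong₂ _<∣>_ (cong (Maybe.map (λ _ → true)) (letter isoˡ x)) (cong (Maybe.map (λ _ → false)) (letter isoʳ x))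

  Wins-++ : ∀ k {ρ : Env ab j} {σ : SetEnv ab m} {ρ′ σ′} →
    Wins sets k a (envˡ ρ) (setEnvˡ σ) a′ (Cat′.envˡ ρ′) (Cat′.setEnvˡ σ′) →
    Wins sets k b (envʳ ρ) (setEnvʳ σ) b′ (Cat′.envʳ ρ′) (Cat′.setEnvʳ σ′) →
    Wins sets k ab ρ σ Cat′.ab ρ′ σ′
  Wins-++ zero w w′ = done (PartialIso-++ (Wins⇒PartialIso w) (Wins⇒PartialIso w′))
  Wins-++ {sets = sets} (suc k) {ρ} {σ} {ρ′} {σ′} wˡ@(round isoˡ pointsˡ subsetsˡ) wʳ@(round isoʳ pointsʳ subsetsʳ) =
    round (PartialIso-++ isoˡ isoʳ) (forth , back) subsets
    where
    idleˡ : Wins sets k a (nothing ∷ envˡ ρ) (setEnvˡ σ) a′ (nothing ∷ Cat′.envˡ ρ′) (Cat′.setEnvˡ σ′)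
    idleˡ = Wins-insertPoint k zero (Wins-pred k wˡ)
    idleʳ : Wins sets k b (nothing ∷ envʳ ρ) (setEnvʳ σ) b′ (nothing ∷ Cat′.envʳ ρ′) (Cat′.setEnvʳ σ′)
    idleʳ = Wins-insertPoint k zero (Wins-pred k wʳ)
    moveˡ : ∀ {i i′} →
      Wins sets k a (just i ∷ envˡ ρ) (setEnvˡ σ) a′ (just i′ ∷ Cat′.envˡ ρ′) (Cat′.setEnvˡ σ′) →
      Wins sets k ab (just (inl xs ys i) ∷ ρ) σ Cat′.ab (just (inl Cat′.xs Cat′.ys i′) ∷ ρ′) σ′
    moveˡ {i} {i′} w = Wins-++ k (Wins-cast (envˡ-inl i ρ) refl (Cat′.envˡ-inl i′ ρ′) refl w)
                                 (Wins-cast (envʳ-inl i ρ) refl (Cat′.envʳ-inl i′ ρ′) refl idleʳ)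
    moveʳ : ∀ {i i′} →
      Wins sets k b (just i ∷ envʳ ρ) (setEnvʳ σ) b′ (just i′ ∷ Cat′.envʳ ρ′) (Cat′.setEnvʳ σ′) →
      Wins sets k ab (just (inr xs ys i) ∷ ρ) σ Cat′.ab (just (inr Cat′.xs Cat′.ys i′) ∷ ρ′) σ′
    moveʳ {i} {i′} w = Wins-++ k (Wins-cast (envˡ-inr i ρ) refl (Cat′.envˡ-inr i′ ρ′) refl idleˡ)
                                 (Wins-cast (envʳ-inr i ρ) refl (Cat′.envʳ-inr i′ ρ′) refl w)
    forth : ∀ p → ∃ λ p′ → Wins sets k ab (just p ∷ ρ) σ Cat′.ab (just p′ ∷ ρ′) σ′
    forth p with splitView xs ys p
    ... | left i  = let i′ , w = proj₁ pointsˡ i in inl Cat′.xs Cat′.ys i′ , moveˡ w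
    ... | right i = let i′ , w = proj₁ pointsʳ i in inr Cat′.xs Cat′.ys i′ , moveʳ w
    back : ∀ p′ → ∃ λ p → Wins sets k ab (just p ∷ ρ) σ Cat′.ab (just p′ ∷ ρ′) σ′
    back p′ with splitView Cat′.xs Cat′.ys p′
    ... | left i′  = let i , w = proj₂ pointsˡ i′ in inl xs ys i , moveˡ w
    ... | right i′ = let i , w = proj₂ pointsʳ i′ in inr xs ys i , moveʳ w
    subsets : T sets → BackAndForth (λ X Y → Wins sets k ab ρ (just X ∷ σ) Cat′.ab ρ′ (just Y ∷ σ′))
    subsets s = subsetForth , subsetBack
      where
      subsetForth : ∀ X → ∃ λ Y → Wins sets k ab ρ (just X ∷ σ) Cat′.ab ρ′ (just Y ∷ σ′)
      subsetForth X =
        let Yˡ , w = proj₁ (subsetsˡ s) (restrictˡ xs ys X)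
            Yʳ , w′ = proj₁ (subsetsʳ s) (restrictʳ xs ys X)
        in glue Cat′.xs Cat′.ys Yˡ Yʳ , Wins-++ k (Wins-cast refl refl refl (Cat′.setEnvˡ-glue Yˡ Yʳ σ′) w)
                                                  (Wins-cast refl refl refl (Cat′.setEnvʳ-glue Yˡ Yʳ σ′) w′)
      subsetBack : ∀ Y → ∃ λ X → Wins sets k ab ρ (just X ∷ σ) Cat′.ab ρ′ (just Y ∷ σ′)
      subsetBack Y =
        let Xˡ , w = proj₂ (subsetsˡ s) (restrictˡ Cat′.xs Cat′.ys Y)
            Xʳ , w′ = proj₂ (subsetsʳ s) (restrictʳ Cat′.xs Cat′.ys Y)
        in glue xs ys Xˡ Xʳ , Wins-++ k (Wins-cast refl (setEnvˡ-glue Xˡ Xʳ σ) refl refl w)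
                                        (Wins-cast refl (setEnvʳ-glue Xˡ Xʳ σ) refl refl w′)

-- First-order logic inside MSO

fromFO : FO j → MSO j 0
fromFO (x <′ y) = x <′ y
fromFO (x ≐ y)  = x ≐ y
fromFO (Pl x)   = Pl x
fromFO (Pr x)   = Pr x
fromFO (φ ∧′ ψ) = fromFO φ ∧′ fromFO ψ
fromFO (φ ∨′ ψ) = fromFO φ ∨′ fromFO ψ
fromFO (¬′ φ)   = ¬′ fromFO φ
fromFO (∃′ φ)   = ∃′ fromFO φ
fromFO (∀′ φ)   = ∀′ fromFO φ

toFO : (φ : MSO j 0) → Admissible false φ → FO j
toFO (x <′ y) _        = x <′ y
toFO (x ≐ y)  _        = x ≐ y
toFO (Pl x)   _        = Pl x
toFO (Pr x)   _        = Pr x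
toFO (x ∈′ ()) _
toFO (φ ∧′ ψ) (a , a′) = toFO φ a ∧′ toFO ψ a′
toFO (φ ∨′ ψ) (a , a′) = toFO φ a ∨′ toFO ψ a′
toFO (¬′ φ)   a        = ¬′ toFO φ a
toFO (∃′ φ)   a        = ∃′ toFO φ a
toFO (∀′ φ)   a        = ∀′ toFO φ a
toFO (∃² φ)   (() , _)
toFO (∀² φ)   (() , _)

fromFO-toFO : ∀ (φ : MSO j 0) a → fromFO (toFO φ a) ≡ φ
fromFO-toFO (x <′ y) _        = refl
fromFO-toFO (x ≐ y)  _        = refl
fromFO-toFO (Pl x)   _        = refl
fromFO-toFO (Pr x)   _        = refl
fromFO-toFO (x ∈′ ()) _
fromFO-toFO (φ ∧′ ψ) (a , a′) = cong₂ _∧′_ (fromFO-toFO φ a) (fromFO-toFO ψ a′)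
fromFO-toFO (φ ∨′ ψ) (a , a′) = cong₂ _∨′_ (fromFO-toFO φ a) (fromFO-toFO ψ a′)
fromFO-toFO (¬′ φ)   a        = cong ¬′_ (fromFO-toFO φ a)
fromFO-toFO (∃′ φ)   a        = cong ∃′_ (fromFO-toFO φ a)
fromFO-toFO (∀′ φ)   a        = cong ∀′_ (fromFO-toFO φ a)
fromFO-toFO (∃² φ)   (() , _)
fromFO-toFO (∀² φ)   (() , _)

fromFO-admissible : ∀ (φ : FO j) → Admissible false (fromFO φ)
fromFO-admissible (x <′ y) = tt
fromFO-admissible (x ≐ y)  = tt
fromFO-admissible (Pl x)   = tt
fromFO-admissible (Pr x)   = tt
fromFO-admissible (φ ∧′ ψ) = fromFO-admissible φ , fromFO-admissible ψ
fromFO-admissible (φ ∨′ ψ) = fromFO-admissible φ , fromFO-admissible ψ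
fromFO-admissible (¬′ φ)   = fromFO-admissible φ
fromFO-admissible (∃′ φ)   = fromFO-admissible φ
fromFO-admissible (∀′ φ)   = fromFO-admissible φ

qr-fromFO : ∀ (φ : FO j) → qrMSO (fromFO φ) ≡ qrFO φ
qr-fromFO (x <′ y) = refl
qr-fromFO (x ≐ y)  = refl
qr-fromFO (Pl x)   = refl
qr-fromFO (Pr x)   = refl
qr-fromFO (φ ∧′ ψ) = cong₂ _⊔_ (qr-fromFO φ) (qr-fromFO ψ)
qr-fromFO (φ ∨′ ψ) = cong₂ _⊔_ (qr-fromFO φ) (qr-fromFO ψ)
qr-fromFO (¬′ φ)   = qr-fromFO φ
qr-fromFO (∃′ φ)   = cong suc (qr-fromFO φ)
qr-fromFO (∀′ φ)   = cong suc (qr-fromFO φ)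

sz-fromFO : ∀ (φ : FO j) → szMSO (fromFO φ) ≡ szFO φ
sz-fromFO (x <′ y) = refl
sz-fromFO (x ≐ y)  = refl
sz-fromFO (Pl x)   = refl
sz-fromFO (Pr x)   = refl
sz-fromFO (φ ∧′ ψ) = cong₂ (λ a b → a + b + 1) (sz-fromFO φ) (sz-fromFO ψ)
sz-fromFO (φ ∨′ ψ) = cong₂ (λ a b → a + b + 1) (sz-fromFO φ) (sz-fromFO ψ)
sz-fromFO (¬′ φ)   = cong (_+ 1) (sz-fromFO φ)
sz-fromFO (∃′ φ)   = cong (_+ 1) (sz-fromFO φ)
sz-fromFO (∀′ φ)   = cong (_+ 1) (sz-fromFO φ)

sat-fromFO : ∀ w (ρ : Vec (Pos w) j) (φ : FO j) → satFO w ρ φ ⇔ satMSO w ρ [] (fromFO φ)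
sat-fromFO w ρ (x <′ y) = ⇔.refl
sat-fromFO w ρ (x ≐ y)  = ⇔.refl
sat-fromFO w ρ (Pl x)   = ⇔.refl
sat-fromFO w ρ (Pr x)   = ⇔.refl
sat-fromFO w ρ (φ ∧′ ψ) = sat-fromFO w ρ φ ×-⇔ sat-fromFO w ρ ψ
sat-fromFO w ρ (φ ∨′ ψ) = sat-fromFO w ρ φ ⊎-⇔ sat-fromFO w ρ ψ
sat-fromFO w ρ (¬′ φ)   = ¬-cong-⇔ (sat-fromFO w ρ φ)
sat-fromFO w ρ (∃′ φ)   = Σ-⇔ (BackAndForth-id λ i → sat-fromFO w (i ∷ ρ) φ)
sat-fromFO w ρ (∀′ φ)   = Π-⇔ (BackAndForth-id λ i → sat-fromFO w (i ∷ ρ) φ)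

toFO-sat : ∀ w (ρ : Vec (Pos w) j) (φ : MSO j 0) a → satFO w ρ (toFO φ a) ⇔ satMSO w ρ [] φ
toFO-sat w ρ φ a = subst (λ θ → satFO w ρ (toFO φ a) ⇔ satMSO w ρ [] θ) (fromFO-toFO φ a) (sat-fromFO w ρ (toFO φ a))

qr-toFO : ∀ (φ : MSO j 0) a → qrFO (toFO φ a) ≡ qrMSO φ
qr-toFO φ a = trans (sym (qr-fromFO (toFO φ a))) (cong qrMSO (fromFO-toFO φ a))

⊆-none : (p : Subset 0) → p ⊆ []
⊆-none [] ()

Wins⇒agree : ∀ {u v} → Wins sets n u [] [] v [] [] →
  (φ : MSO 0 0) → Admissible sets φ → effRank φ ≤ n → u ⊨MSO φ ⇔ v ⊨MSO φ
Wins⇒agree w φ a e≤n = Wins-sound φ {ρ = []} {[]} {ρ′ = []} {[]} [] [] a e≤n (⊆-none _) (⊆-none _) w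

_≈MSO[_]_ : Word → ℕ → Word → Set
u ≈MSO[ n ] v = Logic.Equiv _⊨MSO_ (MSOrank n) u v

_≈FO[_]_ : Word → ℕ → Word → Set
u ≈FO[ n ] v = Logic.Equiv _⊨FO_ (FOrank n) u v

MSO-equiv⇒Wins : ∀ {u v} → u ≈MSO[ n ] v → Wins true n u [] [] v [] []
MSO-equiv⇒Wins {n} {u} {v} u≈v = hintikka-wins true n u [] []
  (transfer (hintikka true n u [] []) (hintikka-within true n u [] []) (hintikka-holds true n u [] []))
  where
  transfer : ∀ f → Holds (Within true n) f → Holds (u ⊨MSO_) f → Holds (v ⊨MSO_) f
  transfer nothing  _         _ = tt
  transfer (just ψ) (_ , r≤n) h = proj₁ (u≈v ψ r≤n) h

FO-equiv⇒Wins : ∀ {u v} → u ≈FO[ n ] v → Wins false n u [] [] v [] []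
FO-equiv⇒Wins {n} {u} {v} u≈v = hintikka-wins false n u [] []
  (transfer (hintikka false n u [] []) (hintikka-within false n u [] []) (hintikka-holds false n u [] []))
  where
  transfer : ∀ f → Holds (Within false n) f → Holds (u ⊨MSO_) f → Holds (v ⊨MSO_) f
  transfer nothing  _         _ = tt
  transfer (just ψ) (a , r≤n) h =
    to (toFO-sat v [] ψ a) (proj₁ (u≈v (toFO ψ a) (subst (_≤ n) (sym (qr-toFO ψ a)) r≤n)) (from (toFO-sat u [] ψ a) h))

⁺++-[] : ∀ (u : Word) → u ⁺++ [] ≡ u
⁺++-[] (x L⁺.∷ xs) = cong (x L⁺.∷_) (++-identityʳ xs)

module EquivProperties {S : Set} (_⊨_ : Word → S → Set) (InL : S → Set) where
  open Logic _⊨_ InL using (Equiv)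

  Equiv-refl : ∀ u → Equiv u u
  Equiv-refl u φ _ = (λ h → h) , (λ h → h)

  Equiv-sym : ∀ {u v} → Equiv u v → Equiv v u
  Equiv-sym u≈v φ p = proj₂ (u≈v φ p) , proj₁ (u≈v φ p)

  Equiv-trans : ∀ {u v w} → Equiv u v → Equiv v w → Equiv u w
  Equiv-trans u≈v v≈w φ p = proj₁ (v≈w φ p) ∘ proj₁ (u≈v φ p) , proj₂ (u≈v φ p) ∘ proj₂ (v≈w φ p)

MSO-congruence : ∀ n {u v} s → u ≈MSO[ n ] v → (u ⁺++ s) ≈MSO[ n ] (v ⁺++ s)
MSO-congruence n {u} {v} []       u≈v rewrite ⁺++-[] u | ⁺++-[] v = u≈v
MSO-congruence n {u} {v} (x ∷ xs) u≈v φ r≤n =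
  ⇔⇒× (Wins⇒agree (Composition.Wins-++ u s v s n (MSO-equiv⇒Wins u≈v) (MSO-equiv⇒Wins s≈s))
                   φ (admissible-true φ) (≤-trans (effRank≤qr φ) r≤n))
  where
  s : Word
  s = x L⁺.∷ xs
  s≈s : s ≈MSO[ n ] s
  s≈s = EquivProperties.Equiv-refl _⊨MSO_ (MSOrank n) s

FO-congruence : ∀ n {u v} s → u ≈FO[ n ] v → (u ⁺++ s) ≈FO[ n ] (v ⁺++ s)
FO-congruence n {u} {v} []       u≈v rewrite ⁺++-[] u | ⁺++-[] v = u≈v
FO-congruence n {u} {v} (x ∷ xs) u≈v φ r≤n =
  ⇔⇒× (⇔.trans (sat-fromFO (u ⁺++⁺ s) [] φ)
        (⇔.trans (Wins⇒agree (Composition.Wins-++ u s v s n (FO-equiv⇒Wins u≈v) (FO-equiv⇒Wins s≈s))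
                             (fromFO φ) (fromFO-admissible φ)
                             (≤-trans (effRank≤qr (fromFO φ)) (subst (_≤ n) (sym (qr-fromFO φ)) r≤n)))
                 (⇔.sym (sat-fromFO (v ⁺++⁺ s) [] φ))))
  where
  s : Word
  s = x L⁺.∷ xs
  s≈s : s ≈FO[ n ] s
  s≈s = EquivProperties.Equiv-refl _⊨FO_ (FOrank n) s

MSO-transfer : ∀ n {u v} → u ≈MSO[ n ] v → ∀ φ → MSOsize (2 * n) φ → u ⊨MSO φ → v ⊨MSO φ
MSO-transfer n u≈v φ sz≤ = to (Wins⇒agree (MSO-equiv⇒Wins u≈v) φ (admissible-true φ) (size⇒effRank≤ φ sz≤))

FO-transfer : ∀ n {u v} → u ≈FO[ n ] v → ∀ φ → FOsize (2 * n) φ → u ⊨FO φ → v ⊨FO φ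
FO-transfer n {u} {v} u≈v φ sz≤ =
  from (sat-fromFO v [] φ) ∘
  to (Wins⇒agree (FO-equiv⇒Wins u≈v) (fromFO φ) (fromFO-admissible φ)
                 (size⇒effRank≤ (fromFO φ) (subst (_≤ 2 * n) (sym (sz-fromFO φ)) sz≤))) ∘
  to (sat-fromFO u [] φ)

-- Pumping

power : ℕ → List A → List A
power zero    z = []
power (suc k) z = z ++ power k z

⁺++-++ : ∀ (u : Word) xs ys → u ⁺++ (xs ++ ys) ≡ (u ⁺++ xs) ⁺++ ys
⁺++-++ (x L⁺.∷ t) xs ys = cong (x L⁺.∷_) (sym (++-assoc t xs ys))

length-⁺++ : ∀ (u : Word) xs → ∣ u ⁺++ xs ∣ ≡ ∣ u ∣ + List.length xs
length-⁺++ (x L⁺.∷ t) xs = cong suc (length-++ t)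

length-power : ∀ k (z : List A) → 1 ≤ List.length z → k ≤ List.length (power k z)
length-power zero    z _   = z≤n
length-power (suc k) z 1≤z = ≤-trans (+-mono-≤ 1≤z (length-power k z 1≤z)) (≤-reflexive (sym (length-++ z)))

prefix : (w : Word) → Pos w → Word
prefix (x L⁺.∷ t) i = x L⁺.∷ List.take (toℕ i) t

take-split : ∀ {m n} (t : List A) → m ≤ n → List.take n t ≡ List.take m t ++ List.drop m (List.take n t)
take-split {A = A} {m} {n} t m≤n = begin
  List.take n t                        ≡⟨ sym (take++drop≡id m (List.take n t)) ⟩
  List.take m (List.take n t) ++ rest  ≡⟨ cong (_++ rest) (take-take m n t) ⟩
  List.take (m ⊓ n) t ++ rest          ≡⟨ cong (λ k → List.take k t ++ rest) (m≤n⇒m⊓n≡m m≤n) ⟩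
  List.take m t ++ rest                ∎
  where
  open ≡-Reasoning
  rest : List A
  rest = List.drop m (List.take n t)

module Pumping {S : Set} (_⊨_ : Word → S → Set) (Coarse Fine : S → Set)
  (congruence : ∀ {u v} s → Logic.Equiv _⊨_ Coarse u v → Logic.Equiv _⊨_ Coarse (u ⁺++ s) (v ⁺++ s))
  (transfer : ∀ {u v} → Logic.Equiv _⊨_ Coarse u v → ∀ φ → Fine φ → u ⊨ φ → v ⊨ φ) where

  open Logic _⊨_ Coarse using (Equiv; IsNumClasses)
  open Logic _⊨_ Fine using (DN≤; LS≤; H≤)
  open EquivProperties _⊨_ Coarse

  record Loop (w : Word) : Set where
    field
      stem : Word
      cycle suffix : List Letter
      cycle-nonempty : 1 ≤ List.length cycle
      decomposition : w ≡ stem ⁺++ (cycle ++ suffix)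
      loop : Equiv (stem ⁺++ cycle) stem

  find-loop : IsNumClasses N → ∀ w → N < ∣ w ∣ → Loop w
  find-loop {N} (rep , _ , cover) w@(x L⁺.∷ t) N<w = record
    { stem = prefix w i₁ ; cycle = cycle ; suffix = List.drop n₂ t
    ; cycle-nonempty = cycle-nonempty ; decomposition = w≡ ; loop = loop }
    where
    class : Pos w → Fin N
    class k = proj₁ (cover (prefix w k))
    collision : ∃ λ i₁ → ∃ λ i₂ → i₁ Fin.< i₂ × class i₁ ≡ class i₂
    collision = pigeonhole N<w class
    i₁ i₂ : Pos w
    i₁ = proj₁ collision
    i₂ = proj₁ (proj₂ collision)
    n₁ n₂ : ℕ
    n₁ = toℕ i₁
    n₂ = toℕ i₂
    n₁<n₂ : n₁ < n₂
    n₁<n₂ = proj₁ (proj₂ (proj₂ collision))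
    n₂≤t : n₂ ≤ List.length t
    n₂≤t = ≤-pred (toℕ<n i₂)
    cycle : List Letter
    cycle = List.drop n₁ (List.take n₂ t)
    cycle-nonempty : 1 ≤ List.length cycle
    cycle-nonempty rewrite length-drop n₁ (List.take n₂ t) | length-take n₂ t | m≤n⇒m⊓n≡m n₂≤t = m<n⇒0<n∸m n₁<n₂
    prefix-i₂ : prefix w i₁ ⁺++ cycle ≡ prefix w i₂
    prefix-i₂ = cong (x L⁺.∷_) (sym (take-split t (<⇒≤ n₁<n₂)))
    w≡ : w ≡ prefix w i₁ ⁺++ (cycle ++ List.drop n₂ t)
    w≡ = cong (x L⁺.∷_) (begin
      t                                            ≡⟨ sym (take++drop≡id n₂ t) ⟩
      List.take n₂ t ++ List.drop n₂ t             ≡⟨ cong (_++ List.drop n₂ t) (take-split t (<⇒≤ n₁<n₂)) ⟩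
      (List.take n₁ t ++ cycle) ++ List.drop n₂ t  ≡⟨ ++-assoc (List.take n₁ t) cycle (List.drop n₂ t) ⟩
      List.take n₁ t ++ (cycle ++ List.drop n₂ t)  ∎)
      where open ≡-Reasoning
    loop : Equiv (prefix w i₁ ⁺++ cycle) (prefix w i₁)
    loop rewrite prefix-i₂ =
      Equiv-trans (proj₂ (cover (prefix w i₂)))
        (subst (λ c → Equiv (rep c) (prefix w i₁)) (proj₂ (proj₂ (proj₂ collision)))
               (Equiv-sym (proj₂ (cover (prefix w i₁)))))

  pump-equiv : ∀ {a} z → Equiv (a ⁺++ z) a → ∀ k s → Equiv (a ⁺++ (power k z ++ s)) (a ⁺++ s)
  pump-equiv {a} z loop zero    s = Equiv-refl (a ⁺++ s)
  pump-equiv {a} z loop (suc k) s = Equiv-trans step (pump-equiv z loop k s)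
    where
    step : Equiv (a ⁺++ ((z ++ power k z) ++ s)) (a ⁺++ (power k z ++ s))
    step rewrite ++-assoc z (power k z) s | ⁺++-++ a z (power k z ++ s) = congruence (power k z ++ s) loop

  record Pumped (w : Word) : Set where
    field
      pumped  : ℕ → Word
      pumped≡ : ∀ k → Equiv (pumped k) w
      shorter : ∣ pumped 0 ∣ < ∣ w ∣
      longer  : ∀ k → k ≤ ∣ pumped k ∣

  pump : IsNumClasses N → ∀ w → N < ∣ w ∣ → Pumped w
  pump classes w N<w = record
    { pumped  = λ k → stem ⁺++ (power k cycle ++ suffix)
    ; pumped≡ = λ k → Equiv-trans (pump-equiv cycle loop k suffix) unpumped≡
    ; shorter = shorter
    ; longer  = longer
    }
    where
    open Loop (find-loop classes w N<w)
    longer : ∀ k → k ≤ ∣ stem ⁺++ (power k cycle ++ suffix) ∣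
    longer k = begin
      k                                                 ≤⟨ length-power k cycle cycle-nonempty ⟩
      List.length (power k cycle)                       ≤⟨ m≤m+n _ _ ⟩
      List.length (power k cycle) + List.length suffix  ≡⟨ sym (length-++ (power k cycle)) ⟩
      List.length (power k cycle ++ suffix)             ≤⟨ m≤n+m _ ∣ stem ∣ ⟩
      ∣ stem ∣ + List.length (power k cycle ++ suffix)  ≡⟨ sym (length-⁺++ stem (power k cycle ++ suffix)) ⟩
      ∣ stem ⁺++ (power k cycle ++ suffix) ∣            ∎
      where open Data.Nat.Properties.≤-Reasoning
    unpumped≡ : Equiv (stem ⁺++ suffix) w
    unpumped≡ = subst (Equiv (stem ⁺++ suffix)) (trans (sym (⁺++-++ stem cycle suffix)) (sym decomposition))
                      (Equiv-sym (congruence suffix loop))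
    shorter : ∣ stem ⁺++ suffix ∣ < ∣ w ∣
    shorter = subst (λ v → ∣ stem ⁺++ suffix ∣ < ∣ v ∣) (sym decomposition) cycle-longer
      where
      cycle-longer : ∣ stem ⁺++ suffix ∣ < ∣ stem ⁺++ (cycle ++ suffix) ∣
      cycle-longer rewrite length-⁺++ stem suffix | length-⁺++ stem (cycle ++ suffix) | length-++ cycle {suffix} =
        +-monoʳ-< ∣ stem ∣ (+-monoˡ-≤ (List.length suffix) cycle-nonempty)

  pumped-models : ∀ {w φ} (P : Pumped w) → Fine φ → w ⊨ φ → ∀ k → Pumped.pumped P k ⊨ φ
  pumped-models P fine w⊨φ k = transfer (Equiv-sym (Pumped.pumped≡ P k)) _ fine w⊨φ

  bounds : IsNumClasses N → DN≤ N × LS≤ N × H≤ N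
  bounds {N} classes = DN-bound , LS-bound , H-bound
    where
    DN-bound : DN≤ N
    DN-bound w (φ , fine , w⊨φ , unique) with ∣ w ∣ ≤? N
    ... | yes w≤N = w≤N
    ... | no  w≰N = ⊥-elim (<-irrefl (cong ∣_∣ (unique _ (pumped-models P fine w⊨φ 0))) shorter)
      where
      P : Pumped w
      P = pump classes w (≰⇒> w≰N)
      open Pumped P
    LS-bound : LS≤ N
    LS-bound φ fine m (inj₁ (m≡0 , _)) = subst (_≤ N) (sym m≡0) z≤n
    LS-bound φ fine m (inj₂ ((w , w⊨φ , w≡m) , minimal)) with ∣ w ∣ ≤? N
    ... | yes w≤N = subst (_≤ N) w≡m w≤N
    ... | no  w≰N = ⊥-elim (<-irrefl (sym w≡m) (≤-<-trans (minimal _ (pumped-models P fine w⊨φ 0)) shorter))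
      where
      P : Pumped w
      P = pump classes w (≰⇒> w≰N)
      open Pumped P
    H-bound : H≤ N
    H-bound φ fine m (inj₁ (m≡0 , _)) = subst (_≤ N) (sym m≡0) z≤n
    H-bound φ fine m (inj₂ ((w , w⊨φ , w≡m) , maximal)) with ∣ w ∣ ≤? N
    ... | yes w≤N = subst (_≤ N) w≡m w≤N
    ... | no  w≰N =
      ⊥-elim (<-irrefl refl (<-≤-trans (n<1+n m) (≤-trans (longer (suc m)) (maximal _ (pumped-models P fine w⊨φ (suc m))))))
      where
      P : Pumped w
      P = pump classes w (≰⇒> w≰N)
      open Pumped P

corollary2 : (n N M : ℕ) →
    Logic.IsNumClasses _⊨FO_ (FOrank n) N →
    Logic.IsNumClasses _⊨MSO_ (MSOrank n) M →
    (Logic.DN≤ _⊨FO_ (FOsize (2 * n)) N ×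
     Logic.LS≤ _⊨FO_ (FOsize (2 * n)) N ×
     Logic.H≤ _⊨FO_ (FOsize (2 * n)) N) ×
    (Logic.DN≤ _⊨MSO_ (MSOsize (2 * n)) M ×
     Logic.LS≤ _⊨MSO_ (MSOsize (2 * n)) M ×
     Logic.H≤ _⊨MSO_ (MSOsize (2 * n)) M)
corollary2 n N M FO-classes MSO-classes =
  Pumping.bounds _⊨FO_ (FOrank n) (FOsize (2 * n)) (FO-congruence n) (FO-transfer n) FO-classes ,
  Pumping.bounds _⊨MSO_ (MSOrank n) (MSOsize (2 * n)) (MSO-congruence n) (MSO-transfer n) MSO-classes
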